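{- Let $n\in\mathbb{N}$. (i) $J_{(0,-1)}(n)=-1$ if $n=1$, $=2$ if $n=2$, and $=0$ if $n>2$. (ii) Write $n=2^a m$ with $m$ odd. Then $J_{(1,-1)}(n)=-\phi(n)$ if $a=0$, $=3\phi(n)$ if $a=1$, and $=\phi(n)$ if $a\geq 2$. (iii) Write $n=2^a m$ with $m$ odd, and let $k\in\{1,3\}$. Then $J_{(0,i^k)}(n)$ equals: $i^k$ if $n=1$; $-1-i^k$ if $n=2$; $0$ if some prime $p\equiv 1\pmod 4$ divides $m$; $2$ if $n=4$; $0$ if $a\geq 3$, or $a=2$ and $m>1$; and $i^k(-1)^{\Omega(n)}2^{\omega(m)}$ otherwise. (iv) Write $n=3^b m_1$ with $\gcd(m_1,3)=1$, let $\omega=e^{2\pi i/3}$ be the principal $3$-rd root of unity, and let $k\in\{1,2\}$. Then $J_{(0,\omega^k)}(n)$ equals: $\omega^k$ if $n=1$; $-\omega^k+1$ if $n=3$; $0$ if some prime $p\equiv 1\pmod 3$ divides $m_1$; $0$ if $b\geq 2$; and $(\omega^k-\omega^{2k})(-1)^{\Omega(n)}2^{\omega(m_1)-1}$ otherwise.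
   Context: For $t\in\mathbb{N}_0$ and a root of unity $\zeta$, the Jordan root totient function is $J_{(t,\zeta)}(n)=\sum_{d\mid n}\zeta^d d^t\mu(n/d)$, with $\mu$ the Möbius function. $\phi$ is Euler's totient function, $i=\sqrt{ -1}$. $\Omega(n)$ is the number of prime factors of $n$ counted with multiplicity and $\omega(n)$ (as a function) the number of distinct prime factors, with $\Omega(1)=\omega(1)=0$. -}

module Defs where

open import Data.Nat using (ℕ; zero; suc; _+_; _*_; _∸_; _^_; _≤?_; _/_)
open import Data.Nat.Divisibility using (_∣_; _∣?_)
open import Data.Nat.Primality using (Prime; prime?)
open import Data.Nat.GCD using (gcd)
open import Data.Integer as ℤ using (ℤ; +_; -[1+_])
open import Data.List using (List; []; _∷_; filter; map; upTo; length; foldr)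
open import Data.Product using (_×_; _,_)
open import Relation.Nullary using (yes; no)
open import Relation.Nullary.Decidable using (_×-dec_)
open import Relation.Binary.PropositionalEquality using (_≡_)
open import Algebra.Bundles.Raw using (RawRing)
open import Level using (0ℓ)

φ : ℕ → ℕ
φ n = length (filter (λ k → gcd (suc k) n Data.Nat.≟ 1) (upTo n))

smallω : ℕ → ℕ
smallω n = length (filter (λ p → prime? p ×-dec (p ∣? n)) (upTo (suc n)))

-- index j of the least divisor (2+j) ≥ 2 of n (default 0)
lpfIdx : ℕ → ℕ
lpfIdx n = go (upTo n)
  where
  go : List ℕ → ℕ
  go [] = 0
  go (j ∷ js) with (2 + j) ∣? n
  ... | yes _ = j
  ... | no _  = go js

ΩF : ℕ → ℕ → ℕ
ΩF zero    n = 0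
ΩF (suc f) n with n ≤? 1
... | yes _ = 0
... | no _  = suc (ΩF f (n / (2 + lpfIdx n)))

bigΩ : ℕ → ℕ
bigΩ n = ΩF n n

sqCount : ℕ → ℕ
sqCount n = length (filter (λ p → prime? p ×-dec ((p * p) ∣? n)) (upTo (suc n)))

μ : ℕ → ℤ
μ n with sqCount n
... | zero  = (ℤ.- ℤ.1ℤ) ℤ.^ smallω n
... | suc _ = ℤ.0ℤ

module _ (R : RawRing 0ℓ 0ℓ) where
  open RawRing R renaming (_+_ to _⊕_; _*_ to _⊗_; -_ to ⊖_)

  natR : ℕ → Carrier
  natR zero    = 0#
  natR (suc n) = 1# ⊕ natR n

  intR : ℤ → Carrier
  intR (+ n)     = natR n
  intR -[1+ n ]  = ⊖ natR (suc n)

  powR : Carrier → ℕ → Carrier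
  powR x zero    = 1#
  powR x (suc n) = x ⊗ powR x n

  sumR : List Carrier → Carrier
  sumR = foldr _⊕_ 0#

  -- Jordan root totient: J_(t,ζ)(n) = Σ_{d ∣ n} ζ^d d^t μ(n/d)
  -- (d ranges over 1..n, written d = suc j)
  Jrt : ℕ → Carrier → ℕ → Carrier
  Jrt t ζ n = sumR (map (λ j → powR ζ (suc j) ⊗ natR (suc j ^ t) ⊗ intR (μ (n / suc j)))
                      (filter (λ j → suc j ∣? n) (upTo n)))

ℤRing : RawRing 0ℓ 0ℓ
ℤRing = ℤ.+-*-rawRing

-- Gaussian integers a + b i  (i² = -1), as a subring of ℂ
record ℤ[i] : Set where
  constructor ⟨_,_⟩ᵢ
  field re im : ℤ

ℤ[i]Ring : RawRing 0ℓ 0ℓ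
ℤ[i]Ring = record
  { Carrier = ℤ[i]
  ; _≈_ = _≡_
  ; _+_ = λ { ⟨ a , b ⟩ᵢ ⟨ c , d ⟩ᵢ → ⟨ (a ℤ.+ c) , (b ℤ.+ d) ⟩ᵢ }
  ; _*_ = λ { ⟨ a , b ⟩ᵢ ⟨ c , d ⟩ᵢ → ⟨ (a ℤ.* c ℤ.- b ℤ.* d) , (a ℤ.* d ℤ.+ b ℤ.* c) ⟩ᵢ }
  ; -_  = λ { ⟨ a , b ⟩ᵢ → ⟨ (ℤ.- a) , (ℤ.- b) ⟩ᵢ }
  ; 0#  = ⟨ ℤ.0ℤ , ℤ.0ℤ ⟩ᵢ
  ; 1#  = ⟨ ℤ.1ℤ , ℤ.0ℤ ⟩ᵢ
  }

𝕚 : ℤ[i]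
𝕚 = ⟨ ℤ.0ℤ , ℤ.1ℤ ⟩ᵢ

-- Eisenstein integers a + b ω  with ω = e^{2πi/3}, so ω² = -1 - ω
record ℤ[ω] : Set where
  constructor ⟨_,_⟩ω
  field re′ om : ℤ

ℤ[ω]Ring : RawRing 0ℓ 0ℓ
ℤ[ω]Ring = record
  { Carrier = ℤ[ω]
  ; _≈_ = _≡_
  ; _+_ = λ { ⟨ a , b ⟩ω ⟨ c , d ⟩ω → ⟨ a ℤ.+ c , b ℤ.+ d ⟩ω }
  -- (a+bω)(c+dω) = ac + (ad+bc)ω + bd ω² = (ac - bd) + (ad + bc - bd) ω
  ; _*_ = λ { ⟨ a , b ⟩ω ⟨ c , d ⟩ω → ⟨ a ℤ.* c ℤ.- b ℤ.* d , a ℤ.* d ℤ.+ b ℤ.* c ℤ.- b ℤ.* d ⟩ω }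
  ; -_  = λ { ⟨ a , b ⟩ω → ⟨ ℤ.- a , ℤ.- b ⟩ω }
  ; 0#  = ⟨ ℤ.0ℤ , ℤ.0ℤ ⟩ω
  ; 1#  = ⟨ ℤ.1ℤ , ℤ.0ℤ ⟩ω
  }

ω₃ : ℤ[ω]
ω₃ = ⟨ ℤ.0ℤ , ℤ.1ℤ ⟩ω

_+ᵢ_ _*ᵢ_ _-ᵢ_ : ℤ[i] → ℤ[i] → ℤ[i]
_+ᵢ_ = RawRing._+_ ℤ[i]Ring
_*ᵢ_ = RawRing._*_ ℤ[i]Ring
x -ᵢ y = x +ᵢ RawRing.-_ ℤ[i]Ring y

_+ω_ _*ω_ _-ω_ : ℤ[ω] → ℤ[ω] → ℤ[ω]
_+ω_ = RawRing._+_ ℤ[ω]Ring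
_*ω_ = RawRing._*_ ℤ[ω]Ring
x -ω y = x +ω RawRing.-_ ℤ[ω]Ring y

infixl 6 _+ᵢ_ _-ᵢ_ _+ω_ _-ω_
infixl 7 _*ᵢ_ _*ω_

module Submission where

-- Every value in the statement is a convolution (g ⋆ μ)(n) = Σ_{d ∣ n} g(d) μ(n/d) with
-- g(d) = ζ^d d^t. For a prime p ∤ m the squarefree divisors of p^(b+1) m are d and p d with
-- d ∣ m, and μ(p d) = −μ(d), so (g ⋆ μ)(p^(b+1) m) = (h ⋆ μ)(m) for h(d) = g(p^(b+1) d) − g(p^b d).
-- For ζ = −1, ±i, ω, ω² the weight ζ^d only depends on d modulo 2, 4 or 3, so peeling off the
-- power of 2 (resp. 3) leaves a constant (whose convolution with μ vanishes on m ≥ 2), the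
-- identity (which gives φ), or the real character χ mod 4 (resp. 3). For a completely
-- multiplicative χ the same peeling gives (χ ⋆ μ)(m) = Π_{p^e ∥ m} χ(p)^(e−1) (χ(p) − 1): zero as
-- soon as χ(p) = 1 for some prime p ∣ m, i.e. p ≡ 1 mod 4 (resp. 3), and (−1)^Ω(m) 2^ω(m) when
-- χ(p) = −1 for every prime p ∣ m.

module JordanRootTotient where
  open import Defs
  open import Level using (0ℓ)
  open import Data.Nat as ℕ
    using (ℕ; zero; suc; _≤_; _<_; z≤n; s≤s; _/_; _%_; _≟_; _≤?_; _^_; NonZero)
  import Data.Nat.Properties as ℕ
  open import Data.Nat.Divisibility
  open import Data.Nat.DivMod
    using (m*n/n≡m; m/n<m; *-/-assoc; m*n/m*o≡n/o; m*[n/m]≡n; m≡m%n+[m/n]*n; m%n<n; %-distribˡ-*; m*n%n≡0)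
  open import Data.Nat.GCD using (gcd; gcd[m,n]∣m; gcd[m,n]∣n; gcd-greatest; gcd[m,n]≢0)
  open import Data.Nat.Coprimality using (Coprime; coprime-divisor)
  open import Data.Nat.Primality
  open import Data.Nat.Induction using (<-rec)
  open import Data.Integer as ℤ using (ℤ; +_; -[1+_]; 0ℤ; 1ℤ; _+_; _-_; -_; _*_)
  import Data.Integer.Properties as ℤ
  open import Data.Integer.Solver using (module +-*-Solver)
  open +-*-Solver using (solve; _:+_; _:*_; :-_; _:-_; _:=_; con)
  open import Algebra.Bundles.Raw using (RawRing)
  open import Algebra.Properties.CommutativeSemigroup ℤ.+-commutativeSemigroup
    using () renaming (interchange to +-interchange)
  open import Algebra.Properties.Ring ℤ.+-*-ring using ([y-z]x≈yx-zx)
  open import Data.List using (List; []; _∷_; filter; map; applyUpTo; upTo; length)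
  open import Data.List.Membership.Propositional.Properties using (∈-length; ∈-filter⁺; ∈-upTo⁺)
  open import Data.Product using (_×_; _,_; proj₁; proj₂; ∃)
  open import Data.Sum using (_⊎_; inj₁; inj₂; reduce)
  open import Data.Empty using (⊥-elim)
  open import Relation.Nullary using (¬_; Dec; yes; no; ¬?)
  open import Relation.Nullary.Decidable using (_×-dec_; from-yes)
  open import Relation.Unary using (Pred; Decidable)
  open import Relation.Binary.PropositionalEquality
  open ℤ[i] using (re; im)
  open ℤ[ω] using (re′; om)

  ∑ : ℕ → (ℕ → ℤ) → ℤ
  ∑ zero    f = 0ℤ
  ∑ (suc n) f = f 0 + ∑ n (λ j → f (suc j))

  when : {P : Set} → Dec P → ℤ → ℤ
  when (yes _) x = x
  when (no _)  x = 0ℤ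

  when-true : ∀ {P : Set} (d : Dec P) x → P → when d x ≡ x
  when-true (yes _) x p = refl
  when-true (no ¬p) x p = ⊥-elim (¬p p)

  when-false : ∀ {P : Set} (d : Dec P) x → ¬ P → when d x ≡ 0ℤ
  when-false (yes p) x ¬p = ⊥-elim (¬p p)
  when-false (no _)  x ¬p = refl

  when-cong : ∀ {P Q : Set} (d : Dec P) (e : Dec Q) {x y} →
              (P → Q) → (Q → P) → (P → x ≡ y) → when d x ≡ when e y
  when-cong (yes p) (yes q) f g h = h p
  when-cong (yes p) (no ¬q) f g h = ⊥-elim (¬q (f p))
  when-cong (no ¬p) (yes q) f g h = ⊥-elim (¬p (g q))
  when-cong (no _)  (no _)  f g h = refl

  when-cong-value : ∀ {P : Set} (d : Dec P) {x y} → (P → x ≡ y) → when d x ≡ when d y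
  when-cong-value d = when-cong d d (λ p → p) (λ p → p)

  when-0 : ∀ {P : Set} (d : Dec P) → when d 0ℤ ≡ 0ℤ
  when-0 (yes _) = refl
  when-0 (no _)  = refl

  when-* : ∀ {P : Set} (d : Dec P) c x → when d (c * x) ≡ c * when d x
  when-* (yes _) c x = refl
  when-* (no _)  c x = sym (ℤ.*-zeroʳ c)

  when-- : ∀ {P : Set} (d : Dec P) x y → when d (x - y) ≡ when d x - when d y
  when-- (yes _) x y = refl
  when-- (no _)  x y = refl

  when-neg : ∀ {P : Set} (d : Dec P) x → when d (- x) ≡ - when d x
  when-neg (yes _) x = refl
  when-neg (no _)  x = refl

  when-split : ∀ {Q : Set} (e : Dec Q) x → x ≡ when e x + when (¬? e) x
  when-split (yes _) x = sym (ℤ.+-identityʳ x)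
  when-split (no _)  x = sym (ℤ.+-identityˡ x)

  when-∧ : ∀ {A B C : Set} (a : Dec A) (b : Dec B) (c : Dec C) x →
           (A × B → C) → (C → A × B) → when a (when b x) ≡ when c x
  when-∧ (yes a) (yes b) (yes c) x f g = refl
  when-∧ (yes a) (yes b) (no ¬c) x f g = ⊥-elim (¬c (f (a , b)))
  when-∧ (yes a) (no ¬b) (yes c) x f g = ⊥-elim (¬b (proj₂ (g c)))
  when-∧ (yes a) (no ¬b) (no ¬c) x f g = refl
  when-∧ (no ¬a) b       (yes c) x f g = ⊥-elim (¬a (proj₁ (g c)))
  when-∧ (no ¬a) b       (no ¬c) x f g = refl

  when-⊎ : ∀ {P Q R : Set} (d : Dec P) (e : Dec Q) (f : Dec R) →
           (P → Q ⊎ R) → (Q → P) → (R → P) → ¬ (Q × R) →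
           when d 1ℤ ≡ when e 1ℤ + when f 1ℤ
  when-⊎ (yes p) (yes q) (yes r) h₁ h₂ h₃ h₄ = ⊥-elim (h₄ (q , r))
  when-⊎ (yes p) (yes q) (no _)  h₁ h₂ h₃ h₄ = refl
  when-⊎ (yes p) (no _)  (yes r) h₁ h₂ h₃ h₄ = refl
  when-⊎ (yes p) (no ¬q) (no ¬r) h₁ h₂ h₃ h₄ with h₁ p
  ... | inj₁ q = ⊥-elim (¬q q)
  ... | inj₂ r = ⊥-elim (¬r r)
  when-⊎ (no ¬p) (yes q) f       h₁ h₂ h₃ h₄ = ⊥-elim (¬p (h₂ q))
  when-⊎ (no ¬p) (no _)  (yes r) h₁ h₂ h₃ h₄ = ⊥-elim (¬p (h₃ r))
  when-⊎ (no _)  (no _)  (no _)  h₁ h₂ h₃ h₄ = refl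

  ∑-cong : ∀ n {f g : ℕ → ℤ} → (∀ j → f j ≡ g j) → ∑ n f ≡ ∑ n g
  ∑-cong zero    h = refl
  ∑-cong (suc n) h = cong₂ _+_ (h 0) (∑-cong n (λ j → h (suc j)))

  ∑-zero : ∀ n {f : ℕ → ℤ} → (∀ j → j < n → f j ≡ 0ℤ) → ∑ n f ≡ 0ℤ
  ∑-zero zero    h = refl
  ∑-zero (suc n) h = cong₂ _+_ (h 0 (s≤s z≤n)) (∑-zero n (λ j j<n → h (suc j) (s≤s j<n)))

  ∑-+ : ∀ n (f g : ℕ → ℤ) → ∑ n (λ j → f j + g j) ≡ ∑ n f + ∑ n g
  ∑-+ zero    f g = refl
  ∑-+ (suc n) f g = trans (cong (λ z → (f 0 + g 0) + z) (∑-+ n (λ j → f (suc j)) (λ j → g (suc j))))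
                          (+-interchange (f 0) (g 0) _ _)

  ∑-* : ∀ n c (f : ℕ → ℤ) → ∑ n (λ j → c * f j) ≡ c * ∑ n f
  ∑-* zero    c f = sym (ℤ.*-zeroʳ c)
  ∑-* (suc n) c f = trans (cong (λ z → c * f 0 + z) (∑-* n c (λ j → f (suc j))))
                          (sym (ℤ.*-distribˡ-+ c (f 0) _))

  ∑-neg : ∀ n (f : ℕ → ℤ) → ∑ n (λ j → - f j) ≡ - ∑ n f
  ∑-neg n f = begin
    ∑ n (λ j → - f j)      ≡⟨ ∑-cong n (λ j → sym (ℤ.-1*i≡-i (f j))) ⟩
    ∑ n (λ j → - 1ℤ * f j) ≡⟨ ∑-* n (- 1ℤ) f ⟩
    - 1ℤ * ∑ n f           ≡⟨ ℤ.-1*i≡-i _ ⟩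
    - ∑ n f                ∎
    where open ≡-Reasoning

  ∑-- : ∀ n (f g : ℕ → ℤ) → ∑ n (λ j → f j - g j) ≡ ∑ n f - ∑ n g
  ∑-- n f g = trans (∑-+ n f (λ j → - g j)) (cong (λ z → ∑ n f + z) (∑-neg n g))

  ∑-++ : ∀ a b (f : ℕ → ℤ) → ∑ (a ℕ.+ b) f ≡ ∑ a f + ∑ b (λ j → f (a ℕ.+ j))
  ∑-++ zero    b f = sym (ℤ.+-identityˡ _)
  ∑-++ (suc a) b f = trans (cong (λ z → f 0 + z) (∑-++ a b (λ j → f (suc j)))) (sym (ℤ.+-assoc (f 0) _ _))

  ∑-comm : ∀ m n (f : ℕ → ℕ → ℤ) → ∑ m (λ i → ∑ n (f i)) ≡ ∑ n (λ j → ∑ m (λ i → f i j))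
  ∑-comm zero    n f = sym (∑-zero n (λ _ _ → refl))
  ∑-comm (suc m) n f = trans (cong (λ z → ∑ n (f 0) + z) (∑-comm m n (λ i → f (suc i))))
                             (sym (∑-+ n (f 0) (λ j → ∑ m (λ i → f (suc i) j))))

  ∑-single : ∀ n k (f : ℕ → ℤ) → k < n → (∀ j → j < n → j ≢ k → f j ≡ 0ℤ) → ∑ n f ≡ f k
  ∑-single (suc n) zero f _ h =
    trans (cong (λ z → f 0 + z) (∑-zero n (λ j j<n → h (suc j) (s≤s j<n) (λ ())))) (ℤ.+-identityʳ _)
  ∑-single (suc n) (suc k) f (s≤s k<n) h =
    trans (cong₂ _+_ (h 0 (s≤s z≤n) (λ ()))
                     (∑-single n k (λ j → f (suc j)) k<n
                        (λ j j<n j≢k → h (suc j) (s≤s j<n) (λ e → j≢k (ℕ.suc-injective e)))))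
          (ℤ.+-identityˡ _)

  ∑-truncate : ∀ m n (f : ℕ → ℤ) → m ≤ n → (∀ j → m ≤ j → j < n → f j ≡ 0ℤ) → ∑ n f ≡ ∑ m f
  ∑-truncate m n f m≤n h = begin
    ∑ n f                                   ≡⟨ cong (λ k → ∑ k f) (sym (ℕ.m+[n∸m]≡n m≤n)) ⟩
    ∑ (m ℕ.+ (n ℕ.∸ m)) f                   ≡⟨ ∑-++ m (n ℕ.∸ m) f ⟩
    ∑ m f + ∑ (n ℕ.∸ m) (λ j → f (m ℕ.+ j)) ≡⟨ cong (λ z → ∑ m f + z) (∑-zero (n ℕ.∸ m) tail≡0) ⟩
    ∑ m f + 0ℤ                              ≡⟨ ℤ.+-identityʳ _ ⟩
    ∑ m f                                   ∎
    where
    open ≡-Reasoning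
    tail≡0 : ∀ j → j < n ℕ.∸ m → f (m ℕ.+ j) ≡ 0ℤ
    tail≡0 j j< = h (m ℕ.+ j) (ℕ.m≤m+n m j) (subst (m ℕ.+ j <_) (ℕ.m+[n∸m]≡n m≤n) (ℕ.+-monoʳ-< m j<))

  ∑-when : ∀ n {P : Set} (e : Dec P) (f : ℕ → ℤ) → ∑ n (λ j → when e (f j)) ≡ when e (∑ n f)
  ∑-when n (yes _) f = refl
  ∑-when n (no _)  f = ∑-zero n (λ _ _ → refl)

  ∑-1 : ∀ n → ∑ n (λ _ → 1ℤ) ≡ + n
  ∑-1 zero    = refl
  ∑-1 (suc n) = cong (λ z → 1ℤ + z) (∑-1 n)

  length-filter : ∀ {P : Pred ℕ 0ℓ} (P? : Decidable P) (h : ℕ → ℕ) n →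
                  + length (filter P? (applyUpTo h n)) ≡ ∑ n (λ j → when (P? (h j)) 1ℤ)
  length-filter P? h zero = refl
  length-filter P? h (suc n) with P? (h 0)
  ... | yes _ = cong (λ z → 1ℤ + z) (length-filter P? (λ j → h (suc j)) n)
  ... | no _  = trans (length-filter P? (λ j → h (suc j)) n) (sym (ℤ.+-identityˡ _))

  sumR-filter : ∀ {P : Pred ℕ 0ℓ} (P? : Decidable P) (F : ℕ → ℤ) (h : ℕ → ℕ) n →
                sumR ℤRing (map F (filter P? (applyUpTo h n))) ≡ ∑ n (λ j → when (P? (h j)) (F (h j)))
  sumR-filter P? F h zero = refl
  sumR-filter P? F h (suc n) with P? (h 0)
  ... | yes _ = cong (λ z → F (h 0) + z) (sumR-filter P? F (λ j → h (suc j)) n)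
  ... | no _  = trans (sumR-filter P? F (λ j → h (suc j)) n) (sym (ℤ.+-identityˡ _))

  ∑-divisors : ℕ → (ℕ → ℕ → ℤ) → ℤ
  ∑-divisors n H = ∑ n (λ j → when (suc j ∣? n) (H (suc j) (n / suc j)))

  ∑-cofactor : ∀ n d X → ∑ (suc n) (λ j → when (d ℕ.* suc j ≟ suc n) X) ≡ when (d ∣? suc n) X
  ∑-cofactor n d X with d ∣? suc n
  ... | no d∤n = ∑-zero (suc n) (λ j _ → when-false (d ℕ.* suc j ≟ suc n) X
                   (λ e → d∤n (divides (suc j) (trans (sym e) (ℕ.*-comm d (suc j))))))
  ... | yes (divides zero eq) = ⊥-elim (ℕ.1+n≢0 eq)
  ... | yes (divides (suc k) eq) with d
  ...   | zero = ⊥-elim (ℕ.1+n≢0 (trans eq (ℕ.*-zeroʳ (suc k))))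
  ...   | suc d′ = trans
            (∑-single (suc n) k _ k≤n (λ j _ j≢k → when-false (suc d′ ℕ.* suc j ≟ suc n) X
              (λ e → j≢k (ℕ.suc-injective (ℕ.*-cancelˡ-≡ (suc j) (suc k) (suc d′)
                (trans e (trans eq (ℕ.*-comm (suc k) (suc d′)))))))))
            (when-true (suc d′ ℕ.* suc k ≟ suc n) X (trans (ℕ.*-comm (suc d′) (suc k)) (sym eq)))
    where
    k≤n : k < suc n
    k≤n = subst (suc k ≤_) (sym eq) (ℕ.m≤m*n (suc k) (suc d′))

  -- d ↦ n / d is an involution on the divisors: both sides count the factorisations d e = n.
  ∑-divisors-flip : ∀ n (H : ℕ → ℕ → ℤ) → ∑-divisors n H ≡ ∑-divisors n (λ d e → H e d)
  ∑-divisors-flip zero    H = refl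
  ∑-divisors-flip (suc n) H = begin
    ∑ N (λ i → when (suc i ∣? N) (H (suc i) (N / suc i)))
      ≡⟨ ∑-cong N (λ i → sym (∑-cofactor n (suc i) (H (suc i) (N / suc i)))) ⟩
    ∑ N (λ i → ∑ N (λ j → when (suc i ℕ.* suc j ≟ N) (H (suc i) (N / suc i))))
      ≡⟨ ∑-cong N (λ i → ∑-cong N (λ j → when-cong (suc i ℕ.* suc j ≟ N) (suc j ℕ.* suc i ≟ N)
            (trans (ℕ.*-comm (suc j) (suc i))) (trans (ℕ.*-comm (suc i) (suc j)))
            (λ e → cong₂ H (sym (quotientˡ i j e)) (quotientʳ i j e)))) ⟩
    ∑ N (λ i → ∑ N (λ j → when (suc j ℕ.* suc i ≟ N) (H (N / suc j) (suc j))))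
      ≡⟨ ∑-comm N N (λ i j → when (suc j ℕ.* suc i ≟ N) (H (N / suc j) (suc j))) ⟩
    ∑ N (λ j → ∑ N (λ i → when (suc j ℕ.* suc i ≟ N) (H (N / suc j) (suc j))))
      ≡⟨ ∑-cong N (λ j → ∑-cofactor n (suc j) (H (N / suc j) (suc j))) ⟩
    ∑ N (λ j → when (suc j ∣? N) (H (N / suc j) (suc j))) ∎
    where
    open ≡-Reasoning
    N = suc n
    quotientˡ : ∀ i j → suc i ℕ.* suc j ≡ N → N / suc j ≡ suc i
    quotientˡ i j e = trans (cong (_/ suc j) (sym e)) (m*n/n≡m (suc i) (suc j))
    quotientʳ : ∀ i j → suc i ℕ.* suc j ≡ N → N / suc i ≡ suc j
    quotientʳ i j e = quotientˡ j i (trans (ℕ.*-comm (suc j) (suc i)) e)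

  ∑-multiples : ∀ c M (F : ℕ → ℤ) →
    ∑ (suc c ℕ.* M) (λ j → when (suc c ∣? suc j) (F (suc j))) ≡ ∑ M (λ j → F (suc c ℕ.* suc j))
  ∑-multiples c′ zero F = cong (λ k → ∑ k (λ j → when (suc c′ ∣? suc j) (F (suc j)))) (ℕ.*-zeroʳ (suc c′))
  ∑-multiples c′ (suc M) F = begin
    ∑ (c ℕ.* suc M) f
      ≡⟨ cong (λ k → ∑ k f) (ℕ.*-suc c M) ⟩
    ∑ (c ℕ.+ c ℕ.* M) f
      ≡⟨ ∑-++ c (c ℕ.* M) f ⟩
    ∑ c f + ∑ (c ℕ.* M) (λ j → f (c ℕ.+ j))
      ≡⟨ cong₂ _+_ first-block (∑-cong (c ℕ.* M) shifted) ⟩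
    F c + ∑ (c ℕ.* M) (λ j → when (c ∣? suc j) (F (c ℕ.+ suc j)))
      ≡⟨ cong (λ z → F c + z) (∑-multiples c′ M (λ x → F (c ℕ.+ x))) ⟩
    F c + ∑ M (λ j → F (c ℕ.+ c ℕ.* suc j))
      ≡⟨ cong₂ _+_ (cong F (sym (ℕ.*-identityʳ c))) (∑-cong M (λ j → cong F (sym (ℕ.*-suc c (suc j))))) ⟩
    ∑ (suc M) (λ j → F (c ℕ.* suc j)) ∎
    where
    open ≡-Reasoning
    c = suc c′
    f = λ j → when (c ∣? suc j) (F (suc j))
    first-block : ∑ c f ≡ F c
    first-block = trans
      (∑-single c c′ f (ℕ.n<1+n c′) (λ j j<c j≢c′ → when-false (c ∣? suc j) _
        (λ c∣ → j≢c′ (ℕ.≤-antisym (ℕ.≤-pred j<c) (ℕ.≤-pred (∣⇒≤ c∣))))))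
      (when-true (c ∣? c) _ ∣-refl)
    shifted : ∀ j → f (c ℕ.+ j) ≡ when (c ∣? suc j) (F (c ℕ.+ suc j))
    shifted j = when-cong (c ∣? suc (c ℕ.+ j)) (c ∣? suc j)
      (λ c∣ → ∣m+n∣m⇒∣n (subst (c ∣_) (sym (ℕ.+-suc c j)) c∣) ∣-refl)
      (λ c∣ → subst (c ∣_) (ℕ.+-suc c j) (∣m∣n⇒∣m+n ∣-refl c∣))
      (λ _ → cong F (sym (ℕ.+-suc c j)))

  prime⇒≥2 : ∀ {p} → Prime p → 2 ≤ p
  prime⇒≥2 {suc (suc _)} _ = s≤s (s≤s z≤n)

  prime⇒≥1 : ∀ {p} → Prime p → 1 ≤ p
  prime⇒≥1 {suc _} _ = s≤s z≤n

  prime∣prime⇒≡ : ∀ {p q} → Prime p → Prime q → q ∣ p → q ≡ p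
  prime∣prime⇒≡ pp pq q∣p with prime⇒irreducible pp q∣p
  ... | inj₂ q≡p = q≡p
  ... | inj₁ refl = ⊥-elim (ℕ.<⇒≱ (prime⇒≥2 pq) ℕ.≤-refl)

  prime∣prime^⇒≡ : ∀ {p q} k → Prime p → Prime q → q ∣ p ^ k → q ≡ p
  prime∣prime^⇒≡ zero    pp pq q∣1 = ⊥-elim (ℕ.<⇒≢ (prime⇒≥2 pq) (sym (∣1⇒≡1 q∣1)))
  prime∣prime^⇒≡ (suc k) pp pq q∣ with euclidsLemma _ _ pq q∣
  ... | inj₁ q∣p  = prime∣prime⇒≡ pp pq q∣p
  ... | inj₂ q∣pᵏ = prime∣prime^⇒≡ k pp pq q∣pᵏ

  1≤* : ∀ {a b} → 1 ≤ a → 1 ≤ b → 1 ≤ a ℕ.* b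
  1≤* {suc a} {suc b} _ _ = s≤s z≤n

  1≤^ : ∀ {p} k → 1 ≤ p → 1 ≤ p ^ k
  1≤^ zero    _   = s≤s z≤n
  1≤^ (suc k) 1≤p = 1≤* 1≤p (1≤^ k 1≤p)

  n≤m*n : ∀ {m} n → 1 ≤ m → n ≤ m ℕ.* n
  n≤m*n {suc m} n _ = ℕ.m≤m+n n _

  odd⇒2∤ : ∀ m → m % 2 ≡ 1 → ¬ 2 ∣ m
  odd⇒2∤ m m%2≡1 2∣m = ℕ.1+n≢0 (trans (sym m%2≡1) (n∣m⇒m%n≡0 m 2 2∣m))

  ∤⇒1≤ : ∀ {p m} → ¬ p ∣ m → 1 ≤ m
  ∤⇒1≤ {m = zero}  p∤0 = ⊥-elim (p∤0 (divides 0 refl))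
  ∤⇒1≤ {m = suc _} _   = s≤s z≤n

  ∤-divisor : ∀ {p m d} → ¬ p ∣ m → d ∣ m → ¬ p ∣ d
  ∤-divisor p∤m d∣m p∣d = p∤m (∣-trans p∣d d∣m)

  HasPrimeFactor≡1-mod : (q : ℕ) .{{_ : NonZero q}} → ℕ → Set
  HasPrimeFactor≡1-mod q m = ∃ λ p → Prime p × p % q ≡ 1 × p ∣ m

  has-prime-factor⇒2≤ : ∀ {q} .{{_ : NonZero q}} m → 1 ≤ m → HasPrimeFactor≡1-mod q m → 2 ≤ m
  has-prime-factor⇒2≤ m 1≤m (p , pp , _ , p∣m) = ℕ.≤-trans (prime⇒≥2 pp) (∣⇒≤ {{ℕ.>-nonZero 1≤m}} p∣m)

  lpf : ℕ → ℕ
  lpf n = 2 ℕ.+ lpfIdx n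

  -- `lpfIdx` is computed by a local helper of Defs; `search` is a metavariable
  -- that the `refl` below forces to be that helper, so it can be reasoned about.
  mutual
    search : ℕ → List ℕ → ℕ
    search = _

    private
      search-is-helper : ∀ n → lpfIdx n ≡ lpfIdx n
      search-is-helper n with upTo n
      ... | xs = refl {x = search n xs}

  search-spec : ∀ n k (f : ℕ → ℕ) →
    (∀ i → i < k → ¬ (2 ℕ.+ f i) ∣ n) ⊎
    (∃ λ i → search n (applyUpTo f k) ≡ f i × (2 ℕ.+ f i) ∣ n × (∀ i′ → i′ < i → ¬ (2 ℕ.+ f i′) ∣ n))
  search-spec n zero f = inj₁ (λ i ())
  search-spec n (suc k) f with (2 ℕ.+ f 0) ∣? n
  ... | yes d = inj₂ (0 , refl , d , λ i′ ())
  ... | no ¬d with search-spec n k (λ x → f (suc x))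
  ...   | inj₁ h = inj₁ λ { zero _ → ¬d ; (suc i) (s≤s i<k) → h i i<k }
  ...   | inj₂ (i , e , d , h) = inj₂ (suc i , e , d , λ { zero _ → ¬d ; (suc i′) (s≤s i′<i) → h i′ i′<i })

  lpf-spec : ∀ n → 2 ≤ n → lpf n ∣ n × (∀ d → 2 ≤ d → d < lpf n → ¬ d ∣ n)
  lpf-spec (suc zero) (s≤s ())
  lpf-spec (suc (suc k)) _ with search-spec (suc (suc k)) (suc (suc k)) (λ x → x)
  ... | inj₁ none = ⊥-elim (none k (ℕ.n≤1+n (suc k)) ∣-refl)
  ... | inj₂ (i , e , d , below) = subst (λ z → (2 ℕ.+ z) ∣ suc (suc k)) (sym e) d , minimal
    where
    minimal : ∀ d → 2 ≤ d → d < lpf (suc (suc k)) → ¬ d ∣ suc (suc k)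
    minimal (suc zero) (s≤s ())
    minimal (suc (suc d′)) _ d< = below d′ (ℕ.≤-pred (ℕ.≤-pred (subst (suc (suc (suc d′)) ≤_) (cong (2 ℕ.+_) e) d<)))

  lpf∣ : ∀ n → 2 ≤ n → lpf n ∣ n
  lpf∣ n 2≤n = proj₁ (lpf-spec n 2≤n)

  lpf-prime : ∀ n → 2 ≤ n → Prime (lpf n)
  lpf-prime n 2≤n = rough∧∣⇒prime rough (lpf∣ n 2≤n)
    where
    rough : lpf n Rough n
    rough (hasNonTrivialDivisor {d} d< d∣n) = proj₂ (lpf-spec n 2≤n) d (ℕ.nonTrivial⇒n>1 d) d< d∣n

  ΩF-fuel : ∀ f f′ n → n ≤ f → n ≤ f′ → ΩF f n ≡ ΩF f′ n
  ΩF-fuel zero    zero     .zero z≤n _ = refl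
  ΩF-fuel zero    (suc f′) .zero z≤n _ = refl
  ΩF-fuel (suc f) zero     .zero _ z≤n = refl
  ΩF-fuel (suc f) (suc f′) n n≤f n≤f′ with n ≤? 1
  ... | yes _   = refl
  ... | no n≰1 = cong suc (ΩF-fuel f f′ _ (ℕ.≤-pred (ℕ.≤-trans q<n n≤f)) (ℕ.≤-pred (ℕ.≤-trans q<n n≤f′)))
    where
    q<n : n / lpf n < n
    q<n = m/n<m n (lpf n) {{ℕ.>-nonZero (ℕ.≤-trans (s≤s z≤n) (ℕ.≰⇒> n≰1))}} (s≤s (s≤s z≤n))

  bigΩ-lpf : ∀ n → 2 ≤ n → bigΩ n ≡ suc (bigΩ (n / lpf n))
  bigΩ-lpf (suc n) 2≤n with suc n ≤? 1
  ... | yes n≤1 = ⊥-elim (ℕ.<⇒≱ 2≤n n≤1)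
  ... | no _    = cong suc (ΩF-fuel n _ _ (ℕ.≤-pred (m/n<m (suc n) (lpf (suc n)) (s≤s (s≤s z≤n)))) ℕ.≤-refl)

  -- Strip the least prime factor q of p x: either q = p, or q ∣ x and induction applies to x / q twice.
  bigΩ-prime* : ∀ x p → Prime p → 1 ≤ x → bigΩ (p ℕ.* x) ≡ suc (bigΩ x)
  bigΩ-prime* = <-rec _ step
    where
    step : ∀ x → (∀ {y} → y < x → ∀ p → Prime p → 1 ≤ y → bigΩ (p ℕ.* y) ≡ suc (bigΩ y)) →
           ∀ p → Prime p → 1 ≤ x → bigΩ (p ℕ.* x) ≡ suc (bigΩ x)
    step x IH p pp 1≤x = by-cases (q ≟ p) (euclidsLemma p x pq (lpf∣ N 2≤N))
      where
      N = p ℕ.* x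
      2≤N : 2 ≤ N
      2≤N = ℕ.≤-trans (prime⇒≥2 pp) (ℕ.m≤m*n p x {{ℕ.>-nonZero 1≤x}})
      q = lpf N
      pq : Prime q
      pq = lpf-prime N 2≤N
      stripped : ∀ y → N ≡ q ℕ.* y → bigΩ N ≡ suc (bigΩ y)
      stripped y N≡qy = trans (bigΩ-lpf N 2≤N)
        (cong (λ z → suc (bigΩ z)) (trans (cong (_/ q) (trans N≡qy (ℕ.*-comm q y))) (m*n/n≡m y q)))
      by-cases : Dec (q ≡ p) → q ∣ p ⊎ q ∣ x → bigΩ N ≡ suc (bigΩ x)
      by-cases (yes q≡p) _ = stripped x (cong (ℕ._* x) (sym q≡p))
      by-cases (no q≢p) (inj₁ q∣p) = ⊥-elim (q≢p (prime∣prime⇒≡ pp pq q∣p))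
      by-cases (no q≢p) (inj₂ (divides x′ x≡x′q)) = begin
        bigΩ N                 ≡⟨ stripped (p ℕ.* x′) N≡qpx′ ⟩
        suc (bigΩ (p ℕ.* x′))  ≡⟨ cong suc (IH x′<x p pp 1≤x′) ⟩
        suc (suc (bigΩ x′))    ≡⟨ cong suc (sym (IH x′<x q pq 1≤x′)) ⟩
        suc (bigΩ (q ℕ.* x′))  ≡⟨ cong (λ z → suc (bigΩ z)) (trans (ℕ.*-comm q x′) (sym x≡x′q)) ⟩
        suc (bigΩ x)           ∎
        where
        open ≡-Reasoning
        1≤x′ : 1 ≤ x′
        1≤x′ = ℕ.n≢0⇒n>0 (λ { refl → ℕ.<⇒≱ 1≤x (ℕ.≤-reflexive x≡x′q) })
        x′<x : x′ < x
        x′<x = subst (x′ <_) (sym x≡x′q) (ℕ.m<m*n x′ q {{ℕ.>-nonZero 1≤x′}} (prime⇒≥2 pq))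
        N≡qpx′ : N ≡ q ℕ.* (p ℕ.* x′)
        N≡qpx′ = trans (cong (p ℕ.*_) x≡x′q) (trans (sym (ℕ.*-assoc p x′ q)) (ℕ.*-comm (p ℕ.* x′) q))

  bigΩ-prime^* : ∀ p k x → Prime p → 1 ≤ x → bigΩ (p ^ k ℕ.* x) ≡ k ℕ.+ bigΩ x
  bigΩ-prime^* p zero    x pp 1≤x = cong bigΩ (ℕ.*-identityˡ x)
  bigΩ-prime^* p (suc k) x pp 1≤x = begin
    bigΩ (p ^ suc k ℕ.* x)    ≡⟨ cong bigΩ (ℕ.*-assoc p (p ^ k) x) ⟩
    bigΩ (p ℕ.* (p ^ k ℕ.* x)) ≡⟨ bigΩ-prime* _ p pp (1≤* (1≤^ k (prime⇒≥1 pp)) 1≤x) ⟩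
    suc (bigΩ (p ^ k ℕ.* x))   ≡⟨ cong suc (bigΩ-prime^* p k x pp 1≤x) ⟩
    suc k ℕ.+ bigΩ x           ∎
    where open ≡-Reasoning

  factor-prime-power : ∀ m p → Prime p → 1 ≤ m → p ∣ m →
    ∃ λ b → ∃ λ m′ → m ≡ p ^ suc b ℕ.* m′ × ¬ p ∣ m′ × 1 ≤ m′
  factor-prime-power = <-rec _ step
    where
    step : ∀ m → (∀ {y} → y < m → ∀ p → Prime p → 1 ≤ y → p ∣ y →
                    ∃ λ b → ∃ λ m′ → y ≡ p ^ suc b ℕ.* m′ × ¬ p ∣ m′ × 1 ≤ m′) →
           ∀ p → Prime p → 1 ≤ m → p ∣ m →
           ∃ λ b → ∃ λ m′ → m ≡ p ^ suc b ℕ.* m′ × ¬ p ∣ m′ × 1 ≤ m′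
    step m IH p pp 1≤m (divides q m≡qp) = by-cases (p ∣? q)
      where
      m≡pq : m ≡ p ℕ.* q
      m≡pq = trans m≡qp (ℕ.*-comm q p)
      1≤q : 1 ≤ q
      1≤q = ℕ.n≢0⇒n>0 (λ { refl → ℕ.<⇒≱ 1≤m (ℕ.≤-reflexive m≡qp) })
      q<m : q < m
      q<m = subst (q <_) (sym m≡qp) (ℕ.m<m*n q p {{ℕ.>-nonZero 1≤q}} (prime⇒≥2 pp))
      by-cases : Dec (p ∣ q) → ∃ λ b → ∃ λ m′ → m ≡ p ^ suc b ℕ.* m′ × ¬ p ∣ m′ × 1 ≤ m′
      by-cases (no p∤q) = 0 , q , trans m≡pq (cong (ℕ._* q) (sym (ℕ.*-identityʳ p))) , p∤q , 1≤q
      by-cases (yes p∣q) with IH q<m p pp 1≤q p∣q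
      ... | b , m′ , q≡ , p∤m′ , 1≤m′ =
        suc b , m′ , trans m≡pq (trans (cong (p ℕ.*_) q≡) (sym (ℕ.*-assoc p (p ^ suc b) m′))) , p∤m′ , 1≤m′

  <prime^suc* : ∀ p b m → Prime p → 1 ≤ m → m < p ^ suc b ℕ.* m
  <prime^suc* p b m pp 1≤m = subst (m <_) (ℕ.*-comm m (p ^ suc b))
    (ℕ.m<m*n m (p ^ suc b) {{ℕ.>-nonZero 1≤m}}
      (ℕ.≤-trans (prime⇒≥2 pp) (ℕ.m≤m*n p (p ^ b) {{ℕ.>-nonZero (1≤^ b (prime⇒≥1 pp))}})))

  count-as-∑ : ∀ {Q : Pred ℕ 0ℓ} (Q? : Decidable Q) x B → 1 ≤ x → x < B → (∀ {j} → Q j → j ∣ x) →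
               + length (filter Q? (upTo (suc x))) ≡ ∑ B (λ j → when (Q? j) 1ℤ)
  count-as-∑ Q? x B 1≤x x<B Q⇒∣ = trans (length-filter Q? (λ j → j) (suc x))
    (sym (∑-truncate (suc x) B _ x<B (λ j x<j _ → when-false (Q? j) 1ℤ
      (λ q → ℕ.<⇒≱ x<j (∣⇒≤ {{ℕ.>-nonZero 1≤x}} (Q⇒∣ q))))))

  ∑-point : ∀ B p → p < B → ∑ B (λ j → when (j ≟ p) 1ℤ) ≡ 1ℤ
  ∑-point B p p<B = trans (∑-single B p _ p<B (λ j _ j≢p → when-false (j ≟ p) 1ℤ j≢p))
                          (when-true (p ≟ p) 1ℤ refl)

  smallω-prime^* : ∀ p b x → Prime p → 1 ≤ x → ¬ p ∣ x → smallω (p ^ suc b ℕ.* x) ≡ suc (smallω x)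
  smallω-prime^* p b x pp 1≤x p∤x = ℤ.+-injective (begin
    + smallω N
      ≡⟨ count-as-∑ (primeDivisor? N) N (suc N) 1≤N ℕ.≤-refl proj₂ ⟩
    ∑ (suc N) (λ j → when (primeDivisor? N j) 1ℤ)
      ≡⟨ ∑-cong (suc N) (λ j → when-⊎ (primeDivisor? N j) (primeDivisor? x j) (j ≟ p)
           (λ { (pj , j∣N) → split pj j∣N })
           (λ { (pj , j∣x) → pj , ∣n⇒∣m*n (p ^ suc b) j∣x })
           (λ { refl → pp , ∣m⇒∣m*n x (∣m⇒∣m*n (p ^ b) ∣-refl) })
           (λ { ((_ , p∣x) , refl) → p∤x p∣x })) ⟩
    ∑ (suc N) (λ j → when (primeDivisor? x j) 1ℤ + when (j ≟ p) 1ℤ)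
      ≡⟨ ∑-+ (suc N) (λ j → when (primeDivisor? x j) 1ℤ) (λ j → when (j ≟ p) 1ℤ) ⟩
    ∑ (suc N) (λ j → when (primeDivisor? x j) 1ℤ) + ∑ (suc N) (λ j → when (j ≟ p) 1ℤ)
      ≡⟨ cong₂ _+_ (sym (count-as-∑ (primeDivisor? x) x (suc N) 1≤x (s≤s x≤N) proj₂))
                   (∑-point (suc N) p (s≤s p≤N)) ⟩
    + smallω x + 1ℤ
      ≡⟨ ℤ.+-comm (+ smallω x) 1ℤ ⟩
    + suc (smallω x) ∎)
    where
    open ≡-Reasoning
    primeDivisor? : ∀ n j → Dec (Prime j × j ∣ n)
    primeDivisor? n j = prime? j ×-dec (j ∣? n)
    N = p ^ suc b ℕ.* x
    x≤N : x ≤ N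
    x≤N = n≤m*n x (1≤^ (suc b) (prime⇒≥1 pp))
    1≤N : 1 ≤ N
    1≤N = ℕ.≤-trans 1≤x x≤N
    p≤N : p ≤ N
    p≤N = ℕ.≤-trans (ℕ.m≤m*n p (p ^ b) {{ℕ.>-nonZero (1≤^ b (prime⇒≥1 pp))}})
                    (ℕ.m≤m*n (p ^ suc b) x {{ℕ.>-nonZero 1≤x}})
    split : ∀ {j} → Prime j → j ∣ N → (Prime j × j ∣ x) ⊎ j ≡ p
    split pj j∣N with euclidsLemma (p ^ suc b) x pj j∣N
    ... | inj₁ j∣pᵇ⁺¹ = inj₂ (prime∣prime^⇒≡ (suc b) pp pj j∣pᵇ⁺¹)
    ... | inj₂ j∣x    = inj₁ (pj , j∣x)

  prime∤⇒coprime : ∀ {p d} → Prime p → ¬ p ∣ d → Coprime d p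
  prime∤⇒coprime pp p∤d {i} (i∣d , i∣p) with prime⇒irreducible pp i∣p
  ... | inj₁ i≡1 = i≡1
  ... | inj₂ refl = ⊥-elim (p∤d i∣d)

  square∣prime*⇒square∣ : ∀ {p q x} → Prime p → Prime q → ¬ p ∣ x → q ℕ.* q ∣ p ℕ.* x → q ℕ.* q ∣ x
  square∣prime*⇒square∣ {p} {q} {x} pp pq p∤x q²∣px with p ∣? q ℕ.* q
  ... | no p∤q² = coprime-divisor (prime∤⇒coprime pp p∤q²) q²∣px
  ... | yes p∣q² = ⊥-elim (p∤x (p≡q⇒p∣x (prime∣prime⇒≡ pq pp (reduce (euclidsLemma q q pp p∣q²)))))
    where
    p≡q⇒p∣x : p ≡ q → p ∣ x
    p≡q⇒p∣x refl = *-cancelˡ-∣ p {{prime⇒nonZero pp}} q²∣px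

  sqCount-prime* : ∀ p x → Prime p → 1 ≤ x → ¬ p ∣ x → sqCount (p ℕ.* x) ≡ sqCount x
  sqCount-prime* p x pp 1≤x p∤x = ℤ.+-injective (begin
    + sqCount N
      ≡⟨ count-as-∑ (primeSquare? N) N (suc N) 1≤N ℕ.≤-refl square⇒∣ ⟩
    ∑ (suc N) (λ j → when (primeSquare? N j) 1ℤ)
      ≡⟨ ∑-cong (suc N) (λ j → when-cong (primeSquare? N j) (primeSquare? x j) {1ℤ}
           (λ { (pj , j²∣N) → pj , square∣prime*⇒square∣ pp pj p∤x j²∣N })
           (λ { (pj , j²∣x) → pj , ∣n⇒∣m*n p j²∣x })
           (λ _ → refl)) ⟩
    ∑ (suc N) (λ j → when (primeSquare? x j) 1ℤ)
      ≡⟨ sym (count-as-∑ (primeSquare? x) x (suc N) 1≤x (s≤s (n≤m*n x (prime⇒≥1 pp))) square⇒∣) ⟩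
    + sqCount x ∎)
    where
    open ≡-Reasoning
    N = p ℕ.* x
    primeSquare? : ∀ n j → Dec (Prime j × j ℕ.* j ∣ n)
    primeSquare? n j = prime? j ×-dec (j ℕ.* j ∣? n)
    square⇒∣ : ∀ {n j} → Prime j × j ℕ.* j ∣ n → j ∣ n
    square⇒∣ {j = j} (_ , j²∣n) = m*n∣⇒m∣ j j j²∣n
    1≤N : 1 ≤ N
    1≤N = 1≤* (prime⇒≥1 pp) 1≤x

  sqCount-prime*-pos : ∀ p x → Prime p → 1 ≤ x → p ∣ x → 0 < sqCount (p ℕ.* x)
  sqCount-prime*-pos p x pp 1≤x p∣x =
    ∈-length (∈-filter⁺ (λ q → prime? q ×-dec (q ℕ.* q ∣? p ℕ.* x)) (∈-upTo⁺ (s≤s p≤px))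
                        (pp , *-monoʳ-∣ p p∣x))
    where
    p≤px : p ≤ p ℕ.* x
    p≤px = ℕ.m≤m*n p x {{ℕ.>-nonZero 1≤x}}

  μ-squarefree : ∀ n → sqCount n ≡ 0 → μ n ≡ (- 1ℤ) ℤ.^ smallω n
  μ-squarefree n sq≡0 with sqCount n
  ... | zero = refl

  μ-not-squarefree : ∀ n → 0 < sqCount n → μ n ≡ 0ℤ
  μ-not-squarefree n 0<sq with sqCount n
  ... | suc _ = refl

  μ-prime*-∣ : ∀ p x → Prime p → 1 ≤ x → p ∣ x → μ (p ℕ.* x) ≡ 0ℤ
  μ-prime*-∣ p x pp 1≤x p∣x = μ-not-squarefree (p ℕ.* x) (sqCount-prime*-pos p x pp 1≤x p∣x)

  μ-prime*-∤ : ∀ p x → Prime p → 1 ≤ x → ¬ p ∣ x → μ (p ℕ.* x) ≡ - μ x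
  μ-prime*-∤ p x pp 1≤x p∤x with sqCount x in sq≡
  ... | zero  = begin
    μ (p ℕ.* x)                              ≡⟨ μ-squarefree (p ℕ.* x) (trans sq-same sq≡) ⟩
    (- 1ℤ) ℤ.^ smallω (p ℕ.* x)              ≡⟨ cong ((- 1ℤ) ℤ.^_) ω-step ⟩
    - 1ℤ * (- 1ℤ) ℤ.^ smallω x               ≡⟨ ℤ.-1*i≡-i _ ⟩
    - ((- 1ℤ) ℤ.^ smallω x)                  ∎
    where
    open ≡-Reasoning
    sq-same = sqCount-prime* p x pp 1≤x p∤x
    ω-step : smallω (p ℕ.* x) ≡ suc (smallω x)
    ω-step = trans (cong (λ z → smallω (z ℕ.* x)) (sym (ℕ.*-identityʳ p))) (smallω-prime^* p 0 x pp 1≤x p∤x)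
  ... | suc _ = μ-not-squarefree (p ℕ.* x) (subst (0 <_) (sym (trans (sqCount-prime* p x pp 1≤x p∤x) sq≡)) (s≤s z≤n))

  -- Dirichlet convolution with μ

  infix 8 _⋆μ_
  _⋆μ_ : (ℕ → ℤ) → ℕ → ℤ
  g ⋆μ n = ∑-divisors n (λ d e → g d * μ e)

  ⋆μ-flip : ∀ g n → g ⋆μ n ≡ ∑-divisors n (λ d e → g e * μ d)
  ⋆μ-flip g n = ∑-divisors-flip n (λ d e → g d * μ e)

  ⋆μ-cong : ∀ n {f g : ℕ → ℤ} → (∀ d → d ∣ n → f d ≡ g d) → f ⋆μ n ≡ g ⋆μ n
  ⋆μ-cong n h = ∑-cong n (λ j → when-cong-value (suc j ∣? n) (λ d∣n → cong (_* μ (n / suc j)) (h (suc j) d∣n)))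

  ⋆μ-zero : ∀ n {f : ℕ → ℤ} → (∀ d → d ∣ n → f d ≡ 0ℤ) → f ⋆μ n ≡ 0ℤ
  ⋆μ-zero n {f} h = trans (⋆μ-cong n {g = λ _ → 0ℤ} h) (∑-zero n (λ j _ → when-0 (suc j ∣? n)))

  ⋆μ-* : ∀ n c (f : ℕ → ℤ) → (λ d → c * f d) ⋆μ n ≡ c * (f ⋆μ n)
  ⋆μ-* n c f = trans
    (∑-cong n (λ j → trans (cong (when (suc j ∣? n)) (ℤ.*-assoc c (f (suc j)) (μ (n / suc j))))
                           (when-* (suc j ∣? n) c _)))
    (∑-* n c _)

  ⋆μ-- : ∀ n (f g : ℕ → ℤ) → (λ d → f d - g d) ⋆μ n ≡ f ⋆μ n - g ⋆μ n
  ⋆μ-- n f g = trans (∑-cong n term) (∑-- n _ _)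
    where
    term : ∀ j → when (suc j ∣? n) ((f (suc j) - g (suc j)) * μ (n / suc j)) ≡
                 when (suc j ∣? n) (f (suc j) * μ (n / suc j)) - when (suc j ∣? n) (g (suc j) * μ (n / suc j))
    term j = trans (cong (when (suc j ∣? n)) ([y-z]x≈yx-zx (μ (n / suc j)) (f (suc j)) (g (suc j))))
                   (when-- (suc j ∣? n) _ _)

  ⋆μ-1 : ∀ f → f ⋆μ 1 ≡ f 1
  ⋆μ-1 f = trans (ℤ.+-identityʳ _) (ℤ.*-identityʳ (f 1))

  coprime∣prime^*⇒∣ : ∀ {p d} k m → Prime p → ¬ p ∣ d → d ∣ p ^ k ℕ.* m → d ∣ m
  coprime∣prime^*⇒∣ {d = d} zero m pp p∤d d∣ = subst (d ∣_) (ℕ.*-identityˡ m) d∣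
  coprime∣prime^*⇒∣ {p} {d} (suc k) m pp p∤d d∣ = coprime∣prime^*⇒∣ k m pp p∤d
    (coprime-divisor (prime∤⇒coprime pp p∤d) (subst (d ∣_) (ℕ.*-assoc p (p ^ k) m) d∣))

  ∑-divisors-prime-to : ∀ p k m (G : ℕ → ℕ → ℤ) → Prime p → 1 ≤ m → ¬ p ∣ m →
    ∑ (p ^ k ℕ.* m) (λ j → when (¬? (p ∣? suc j)) (when (suc j ∣? p ^ k ℕ.* m) (G (suc j) ((p ^ k ℕ.* m) / suc j))))
    ≡ ∑-divisors m (λ d e → G d (p ^ k ℕ.* e))
  ∑-divisors-prime-to p k m G pp 1≤m p∤m =
    trans (∑-cong N term) (∑-truncate m N _ m≤N (λ j m≤j _ → when-false (suc j ∣? m) _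
      (λ d∣m → ℕ.<⇒≱ (s≤s m≤j) (∣⇒≤ {{ℕ.>-nonZero 1≤m}} d∣m))))
    where
    N = p ^ k ℕ.* m
    m≤N : m ≤ N
    m≤N = n≤m*n m (1≤^ k (prime⇒≥1 pp))
    term : ∀ j → when (¬? (p ∣? suc j)) (when (suc j ∣? N) (G (suc j) (N / suc j)))
                 ≡ when (suc j ∣? m) (G (suc j) (p ^ k ℕ.* (m / suc j)))
    term j with p ∣? suc j
    ... | yes p∣d = sym (when-false (suc j ∣? m) _ (λ d∣m → p∤m (∣-trans p∣d d∣m)))
    ... | no p∤d  = when-cong (suc j ∣? N) (suc j ∣? m)
          (coprime∣prime^*⇒∣ k m pp p∤d) (∣n⇒∣m*n (p ^ k))
          (λ d∣N → cong (G (suc j)) (*-/-assoc (p ^ k) (coprime∣prime^*⇒∣ k m pp p∤d d∣N)))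

  divisor-term-prime* : ∀ c n′ (g : ℕ → ℤ) j → Prime (suc c) → let p = suc c in
    when (p ℕ.* suc j ∣? p ℕ.* n′) (g ((p ℕ.* n′) / (p ℕ.* suc j)) * μ (p ℕ.* suc j))
    ≡ when (¬? (p ∣? suc j)) (when (suc j ∣? n′) (g (n′ / suc j) * - μ (suc j)))
  divisor-term-prime* c n′ g j pp with suc c ∣? suc j
  ... | yes p∣d = trans (cong (when (p ℕ.* suc j ∣? p ℕ.* n′))
                             (trans (cong (g q *_) (μ-prime*-∣ p (suc j) pp (s≤s z≤n) p∣d)) (ℤ.*-zeroʳ (g q))))
                       (when-0 (p ℕ.* suc j ∣? p ℕ.* n′))
    where
    p = suc c
    q = (p ℕ.* n′) / (p ℕ.* suc j)
  ... | no p∤d = when-cong (p ℕ.* suc j ∣? p ℕ.* n′) (suc j ∣? n′) (*-cancelˡ-∣ p) (*-monoʳ-∣ p)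
          (λ _ → cong₂ _*_ (cong g (m*n/m*o≡n/o p n′ (suc j))) (μ-prime*-∤ p (suc j) pp (s≤s z≤n) p∤d))
    where p = suc c

  -- The terms with p ∣ d vanish unless d = p d′ with p ∤ d′, where μ (p d′) = - μ d′.
  ∑-divisors-multiples-of : ∀ p b m (g : ℕ → ℤ) → Prime p → 1 ≤ m → ¬ p ∣ m →
    let n = p ^ suc b ℕ.* m in
    ∑ n (λ j → when (p ∣? suc j) (when (suc j ∣? n) (g (n / suc j) * μ (suc j))))
    ≡ - ((λ e → g (p ^ b ℕ.* e)) ⋆μ m)
  ∑-divisors-multiples-of (suc c) b m g pp 1≤m p∤m = begin
    ∑ n (λ j → when (p ∣? suc j) (when (suc j ∣? n) (g (n / suc j) * μ (suc j))))
      ≡⟨ cong (λ x → ∑ x (λ j → when (p ∣? suc j) (when (suc j ∣? x) (g (x / suc j) * μ (suc j)))))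
              (ℕ.*-assoc p (p ^ b) m) ⟩
    ∑ (p ℕ.* n′) (λ j → when (p ∣? suc j) (F (suc j)))
      ≡⟨ ∑-multiples c n′ F ⟩
    ∑ n′ (λ j → F (p ℕ.* suc j))
      ≡⟨ ∑-cong n′ (λ j → divisor-term-prime* c n′ g j pp) ⟩
    ∑ n′ (λ j → when (¬? (p ∣? suc j)) (when (suc j ∣? n′) (g (n′ / suc j) * - μ (suc j))))
      ≡⟨ ∑-divisors-prime-to p b m (λ d e → g e * - μ d) pp 1≤m p∤m ⟩
    ∑-divisors m (λ d e → gᵇ e * - μ d)
      ≡⟨ ∑-cong m (λ j → trans (cong (when (suc j ∣? m)) (sym (ℤ.neg-distribʳ-* (gᵇ (m / suc j)) (μ (suc j)))))
                              (when-neg (suc j ∣? m) (gᵇ (m / suc j) * μ (suc j)))) ⟩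
    ∑ m (λ j → - when (suc j ∣? m) (gᵇ (m / suc j) * μ (suc j)))
      ≡⟨ ∑-neg m _ ⟩
    - ∑-divisors m (λ d e → gᵇ e * μ d)
      ≡⟨ cong -_ (sym (⋆μ-flip gᵇ m)) ⟩
    - (gᵇ ⋆μ m) ∎
    where
    open ≡-Reasoning
    p = suc c
    n = p ^ suc b ℕ.* m
    n′ = p ^ b ℕ.* m
    gᵇ : ℕ → ℤ
    gᵇ e = g (p ^ b ℕ.* e)
    F : ℕ → ℤ
    F zero    = 0ℤ
    F (suc k) = when (suc k ∣? p ℕ.* n′) (g ((p ℕ.* n′) / suc k) * μ (suc k))

  ⋆μ-peel : ∀ p b m (g : ℕ → ℤ) → Prime p → 1 ≤ m → ¬ p ∣ m →
    g ⋆μ (p ^ suc b ℕ.* m) ≡ (λ d → g (p ^ suc b ℕ.* d) - g (p ^ b ℕ.* d)) ⋆μ m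
  ⋆μ-peel p b m g pp 1≤m p∤m = begin
    g ⋆μ n
      ≡⟨ ⋆μ-flip g n ⟩
    ∑ n T
      ≡⟨ ∑-cong n (λ j → when-split (p ∣? suc j) (T j)) ⟩
    ∑ n (λ j → when (p ∣? suc j) (T j) + when (¬? (p ∣? suc j)) (T j))
      ≡⟨ ∑-+ n (λ j → when (p ∣? suc j) (T j)) (λ j → when (¬? (p ∣? suc j)) (T j)) ⟩
    ∑ n (λ j → when (p ∣? suc j) (T j)) + ∑ n (λ j → when (¬? (p ∣? suc j)) (T j))
      ≡⟨ cong₂ _+_ (∑-divisors-multiples-of p b m g pp 1≤m p∤m)
                   (trans (∑-divisors-prime-to p (suc b) m (λ d e → g e * μ d) pp 1≤m p∤m) (sym (⋆μ-flip gᵇ⁺¹ m))) ⟩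
    - (gᵇ ⋆μ m) + gᵇ⁺¹ ⋆μ m
      ≡⟨ ℤ.+-comm (- (gᵇ ⋆μ m)) (gᵇ⁺¹ ⋆μ m) ⟩
    gᵇ⁺¹ ⋆μ m - gᵇ ⋆μ m
      ≡⟨ sym (⋆μ-- m gᵇ⁺¹ gᵇ) ⟩
    (λ d → gᵇ⁺¹ d - gᵇ d) ⋆μ m ∎
    where
    open ≡-Reasoning
    n = p ^ suc b ℕ.* m
    gᵇ gᵇ⁺¹ : ℕ → ℤ
    gᵇ e = g (p ^ b ℕ.* e)
    gᵇ⁺¹ e = g (p ^ suc b ℕ.* e)
    T : ℕ → ℤ
    T j = when (suc j ∣? n) (g (n / suc j) * μ (suc j))

  module CompletelyMultiplicative
    (χ : ℕ → ℤ) (χ-* : ∀ a b → χ (a ℕ.* b) ≡ χ a * χ b) (χ-1 : χ 1 ≡ 1ℤ) where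

    χ-prime^* : ∀ p k d → χ (p ^ k ℕ.* d) ≡ χ p ℤ.^ k * χ d
    χ-prime^* p zero    d = trans (cong χ (ℕ.*-identityˡ d)) (sym (ℤ.*-identityˡ (χ d)))
    χ-prime^* p (suc k) d = begin
      χ (p ^ suc k ℕ.* d)            ≡⟨ cong χ (ℕ.*-assoc p (p ^ k) d) ⟩
      χ (p ℕ.* (p ^ k ℕ.* d))        ≡⟨ χ-* p (p ^ k ℕ.* d) ⟩
      χ p * χ (p ^ k ℕ.* d)          ≡⟨ cong (χ p *_) (χ-prime^* p k d) ⟩
      χ p * (χ p ℤ.^ k * χ d)        ≡⟨ sym (ℤ.*-assoc (χ p) (χ p ℤ.^ k) (χ d)) ⟩
      χ p ℤ.^ suc k * χ d            ∎
      where open ≡-Reasoning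

    χ-difference : ∀ p b d → χ (p ^ suc b ℕ.* d) - χ (p ^ b ℕ.* d) ≡ χ p ℤ.^ b * (χ p - 1ℤ) * χ d
    χ-difference p b d = begin
      χ (p ^ suc b ℕ.* d) - χ (p ^ b ℕ.* d)    ≡⟨ cong₂ _-_ (χ-prime^* p (suc b) d) (χ-prime^* p b d) ⟩
      χ p * χ p ℤ.^ b * χ d - χ p ℤ.^ b * χ d  ≡⟨ solve 3 (λ x y z → x :* y :* z :- y :* z := y :* (x :- con 1ℤ) :* z)
                                                          refl (χ p) (χ p ℤ.^ b) (χ d) ⟩
      χ p ℤ.^ b * (χ p - 1ℤ) * χ d             ∎
      where open ≡-Reasoning

    χ⋆μ≡0 : ∀ m p → 1 ≤ m → Prime p → p ∣ m → χ p ≡ 1ℤ → χ ⋆μ m ≡ 0ℤ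
    χ⋆μ≡0 m p 1≤m pp p∣m χp≡1 with factor-prime-power m p pp 1≤m p∣m
    ... | b , m′ , m≡ , p∤m′ , 1≤m′ =
      trans (cong (χ ⋆μ_) m≡) (trans (⋆μ-peel p b m′ χ pp 1≤m′ p∤m′) (⋆μ-zero m′ (λ d _ → difference≡0 d)))
      where
      difference≡0 : ∀ d → χ (p ^ suc b ℕ.* d) - χ (p ^ b ℕ.* d) ≡ 0ℤ
      difference≡0 d = begin
        χ (p ^ suc b ℕ.* d) - χ (p ^ b ℕ.* d)  ≡⟨ χ-difference p b d ⟩
        χ p ℤ.^ b * (χ p - 1ℤ) * χ d           ≡⟨ cong (λ x → x ℤ.^ b * (x - 1ℤ) * χ d) χp≡1 ⟩
        1ℤ ℤ.^ b * 0ℤ * χ d                    ≡⟨ cong (_* χ d) (ℤ.*-zeroʳ (1ℤ ℤ.^ b)) ⟩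
        0ℤ * χ d                               ≡⟨ ℤ.*-zeroˡ (χ d) ⟩
        0ℤ                                     ∎
        where open ≡-Reasoning

    χ⋆μ≡signed-2^ω : ∀ m → 1 ≤ m → (∀ q → Prime q → q ∣ m → χ q ≡ - 1ℤ) →
                    χ ⋆μ m ≡ (- 1ℤ) ℤ.^ bigΩ m * + (2 ^ smallω m)
    χ⋆μ≡signed-2^ω = <-rec _ step
      where
      Goal : ℕ → Set
      Goal m = 1 ≤ m → (∀ q → Prime q → q ∣ m → χ q ≡ - 1ℤ) →
               χ ⋆μ m ≡ (- 1ℤ) ℤ.^ bigΩ m * + (2 ^ smallω m)
      step : ∀ m → (∀ {y} → y < m → Goal y) → Goal m
      step (suc zero)      IH _   _      = trans (⋆μ-1 χ) χ-1
      step m@(suc (suc _)) IH 1≤m χq≡-1 = peeled (factor-prime-power m p pp 1≤m (lpf∣ m 2≤m))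
        where
        2≤m : 2 ≤ m
        2≤m = s≤s (s≤s z≤n)
        p = lpf m
        pp = lpf-prime m 2≤m
        peeled : (∃ λ b → ∃ λ m′ → m ≡ p ^ suc b ℕ.* m′ × ¬ p ∣ m′ × 1 ≤ m′) →
                 χ ⋆μ m ≡ (- 1ℤ) ℤ.^ bigΩ m * + (2 ^ smallω m)
        peeled (b , m′ , m≡ , p∤m′ , 1≤m′) = begin
          χ ⋆μ m                                                ≡⟨ cong (χ ⋆μ_) m≡ ⟩
          χ ⋆μ (p ^ suc b ℕ.* m′)                               ≡⟨ ⋆μ-peel p b m′ χ pp 1≤m′ p∤m′ ⟩
          (λ d → χ (p ^ suc b ℕ.* d) - χ (p ^ b ℕ.* d)) ⋆μ m′   ≡⟨ ⋆μ-cong m′ (λ d _ → χ-difference p b d) ⟩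
          (λ d → c * χ d) ⋆μ m′                                 ≡⟨ ⋆μ-* m′ c χ ⟩
          c * χ ⋆μ m′                                           ≡⟨ cong (c *_) (IH m′<m 1≤m′ χq′≡-1) ⟩
          c * ((- 1ℤ) ℤ.^ bigΩ m′ * + (2 ^ smallω m′))          ≡⟨ cong (λ x → x ℤ.^ b * (x - 1ℤ) * _) χp≡-1 ⟩
          (- 1ℤ) ℤ.^ b * - + 2 * ((- 1ℤ) ℤ.^ bigΩ m′ * + (2 ^ smallω m′))
            ≡⟨ solve 3 (λ s a t → s :* :- con (+ 2) :* (a :* t) := (con (- 1ℤ) :* s :* a) :* (con (+ 2) :* t))
                       refl ((- 1ℤ) ℤ.^ b) ((- 1ℤ) ℤ.^ bigΩ m′) (+ (2 ^ smallω m′)) ⟩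
          (- 1ℤ) ℤ.^ suc b * (- 1ℤ) ℤ.^ bigΩ m′ * (+ 2 * + (2 ^ smallω m′))
            ≡⟨ cong₂ _*_ (sym (ℤ.^-distribˡ-+-* (- 1ℤ) (suc b) (bigΩ m′))) (sym (ℤ.pos-* 2 (2 ^ smallω m′))) ⟩
          (- 1ℤ) ℤ.^ (suc b ℕ.+ bigΩ m′) * + (2 ^ suc (smallω m′))
            ≡⟨ cong₂ (λ u v → (- 1ℤ) ℤ.^ u * + (2 ^ v))
                     (sym (trans (cong bigΩ m≡) (bigΩ-prime^* p (suc b) m′ pp 1≤m′)))
                     (sym (trans (cong smallω m≡) (smallω-prime^* p b m′ pp 1≤m′ p∤m′))) ⟩
          (- 1ℤ) ℤ.^ bigΩ m * + (2 ^ smallω m) ∎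
          where
          open ≡-Reasoning
          c = χ p ℤ.^ b * (χ p - 1ℤ)
          χp≡-1 : χ p ≡ - 1ℤ
          χp≡-1 = χq≡-1 p pp (lpf∣ m 2≤m)
          χq′≡-1 : ∀ q → Prime q → q ∣ m′ → χ q ≡ - 1ℤ
          χq′≡-1 q pq q∣m′ = χq≡-1 q pq (subst (q ∣_) (sym m≡) (∣n⇒∣m*n (p ^ suc b) q∣m′))
          m′<m : m′ < m
          m′<m = subst (m′ <_) (sym m≡) (<prime^suc* p b m′ pp 1≤m′)

    χ-p^suc*≡0 : ∀ p b d → χ p ≡ 0ℤ → χ (p ^ suc b ℕ.* d) ≡ 0ℤ
    χ-p^suc*≡0 p b d χp≡0 = trans (χ-prime^* p (suc b) d)
      (trans (cong (λ x → x ℤ.^ suc b * χ d) χp≡0) (ℤ.*-zeroˡ (χ d)))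

    χ⋆μ-p* : ∀ p m → χ p ≡ 0ℤ → Prime p → 1 ≤ m → ¬ p ∣ m → χ ⋆μ (p ^ 1 ℕ.* m) ≡ - (χ ⋆μ m)
    χ⋆μ-p* p m χp≡0 pp 1≤m p∤m = begin
      χ ⋆μ (p ^ 1 ℕ.* m)                                ≡⟨ ⋆μ-peel p 0 m χ pp 1≤m p∤m ⟩
      (λ d → χ (p ^ 1 ℕ.* d) - χ (p ^ 0 ℕ.* d)) ⋆μ m    ≡⟨ ⋆μ-cong m (λ d _ → difference d) ⟩
      (λ d → - 1ℤ * χ d) ⋆μ m                           ≡⟨ ⋆μ-* m (- 1ℤ) χ ⟩
      - 1ℤ * χ ⋆μ m                                     ≡⟨ ℤ.-1*i≡-i _ ⟩
      - (χ ⋆μ m)                                        ∎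
      where
      open ≡-Reasoning
      difference : ∀ d → χ (p ^ 1 ℕ.* d) - χ (p ^ 0 ℕ.* d) ≡ - 1ℤ * χ d
      difference d = begin
        χ (p ^ 1 ℕ.* d) - χ (p ^ 0 ℕ.* d)  ≡⟨ cong₂ _-_ (χ-p^suc*≡0 p 0 d χp≡0) (cong χ (ℕ.*-identityˡ d)) ⟩
        0ℤ - χ d                           ≡⟨ ℤ.+-identityˡ (- χ d) ⟩
        - χ d                              ≡⟨ ℤ.-1*i≡-i (χ d) ⟨
        - 1ℤ * χ d                         ∎

    χ⋆μ-p²* : ∀ p b m → χ p ≡ 0ℤ → Prime p → 1 ≤ m → ¬ p ∣ m → χ ⋆μ (p ^ suc (suc b) ℕ.* m) ≡ 0ℤ
    χ⋆μ-p²* p b m χp≡0 pp 1≤m p∤m = trans (⋆μ-peel p (suc b) m χ pp 1≤m p∤m)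
      (⋆μ-zero m (λ d _ → cong₂ _-_ (χ-p^suc*≡0 p (suc b) d χp≡0) (χ-p^suc*≡0 p b d χp≡0)))

    χ⋆μ-p^≤1 : ∀ p a m c → χ p ≡ 0ℤ → Prime p → 1 ≤ m → ¬ p ∣ m → a ≡ 0 ⊎ a ≡ 1 →
               χ ⋆μ m ≡ (- 1ℤ) ℤ.^ bigΩ m * c → χ ⋆μ (p ^ a ℕ.* m) ≡ (- 1ℤ) ℤ.^ bigΩ (p ^ a ℕ.* m) * c
    χ⋆μ-p^≤1 p a m c χp≡0 pp 1≤m p∤m (inj₁ refl) χ⋆μm≡ =
      subst (λ x → χ ⋆μ x ≡ (- 1ℤ) ℤ.^ bigΩ x * c) (sym (ℕ.*-identityˡ m)) χ⋆μm≡
    χ⋆μ-p^≤1 p a m c χp≡0 pp 1≤m p∤m (inj₂ refl) χ⋆μm≡ = begin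
      χ ⋆μ (p ^ 1 ℕ.* m)                        ≡⟨ χ⋆μ-p* p m χp≡0 pp 1≤m p∤m ⟩
      - (χ ⋆μ m)                                ≡⟨ cong -_ χ⋆μm≡ ⟩
      - ((- 1ℤ) ℤ.^ bigΩ m * c)                 ≡⟨ ℤ.neg-distribˡ-* ((- 1ℤ) ℤ.^ bigΩ m) c ⟩
      - ((- 1ℤ) ℤ.^ bigΩ m) * c                 ≡⟨ cong (_* c) (sym (ℤ.-1*i≡-i ((- 1ℤ) ℤ.^ bigΩ m))) ⟩
      (- 1ℤ) ℤ.^ suc (bigΩ m) * c               ≡⟨ cong (λ e → (- 1ℤ) ℤ.^ e * c) (sym (bigΩ-prime^* p 1 m pp 1≤m)) ⟩
      (- 1ℤ) ℤ.^ bigΩ (p ^ 1 ℕ.* m) * c         ∎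
      where open ≡-Reasoning

  const⋆μ≡0 : ∀ c m → 2 ≤ m → (λ _ → c) ⋆μ m ≡ 0ℤ
  const⋆μ≡0 c m 2≤m = begin
    (λ _ → c) ⋆μ m          ≡⟨ ⋆μ-cong m (λ _ _ → sym (ℤ.*-identityʳ c)) ⟩
    (λ _ → c * 1ℤ) ⋆μ m     ≡⟨ ⋆μ-* m c (λ _ → 1ℤ) ⟩
    c * (λ _ → 1ℤ) ⋆μ m     ≡⟨ cong (c *_) (One.χ⋆μ≡0 m (lpf m) (ℕ.≤-trans (s≤s z≤n) 2≤m)
                                                     (lpf-prime m 2≤m) (lpf∣ m 2≤m) refl) ⟩
    c * 0ℤ                  ≡⟨ ℤ.*-zeroʳ c ⟩
    0ℤ                      ∎
    where
    open ≡-Reasoning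
    module One = CompletelyMultiplicative (λ _ → 1ℤ) (λ _ _ → refl) refl

  ∑μ-divisors : ∀ n → 1 ≤ n → ∑-divisors n (λ d _ → μ d) ≡ when (n ≟ 1) 1ℤ
  ∑μ-divisors n 1≤n = begin
    ∑-divisors n (λ d _ → μ d)
      ≡⟨ ∑-cong n (λ j → cong (when (suc j ∣? n)) (sym (ℤ.*-identityˡ (μ (suc j))))) ⟩
    ∑-divisors n (λ d _ → 1ℤ * μ d)     ≡⟨ sym (⋆μ-flip (λ _ → 1ℤ) n) ⟩
    (λ _ → 1ℤ) ⋆μ n                     ≡⟨ by-cases (n ≟ 1) ⟩
    when (n ≟ 1) 1ℤ                     ∎
    where
    open ≡-Reasoning
    by-cases : (e : Dec (n ≡ 1)) → (λ _ → 1ℤ) ⋆μ n ≡ when e 1ℤ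
    by-cases (yes refl) = ⋆μ-1 (λ _ → 1ℤ)
    by-cases (no n≢1)   = const⋆μ≡0 1ℤ n (ℕ.≤∧≢⇒< 1≤n (λ 1≡n → n≢1 (sym 1≡n)))

  coprime-indicator : ∀ n k → 1 ≤ n →
    when (gcd (suc k) n ≟ 1) 1ℤ ≡ ∑ n (λ j → when (suc j ∣? n) (when (suc j ∣? suc k) (μ (suc j))))
  coprime-indicator n k 1≤n = sym (begin
    ∑ n (λ j → when (suc j ∣? n) (when (suc j ∣? suc k) (μ (suc j))))
      ≡⟨ ∑-cong n (λ j → when-∧ (suc j ∣? n) (suc j ∣? suc k) (suc j ∣? g) (μ (suc j))
            (λ (d∣n , d∣k) → gcd-greatest d∣k d∣n)
            (λ d∣g → ∣-trans d∣g (gcd[m,n]∣n (suc k) n) , ∣-trans d∣g (gcd[m,n]∣m (suc k) n))) ⟩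
    ∑ n (λ j → when (suc j ∣? g) (μ (suc j)))
      ≡⟨ ∑-truncate g n _ g≤n (λ j g≤j _ → when-false (suc j ∣? g) _
           (λ d∣g → ℕ.<⇒≱ (s≤s g≤j) (∣⇒≤ {{ℕ.>-nonZero 1≤g}} d∣g))) ⟩
    ∑-divisors g (λ d _ → μ d)
      ≡⟨ ∑μ-divisors g 1≤g ⟩
    when (g ≟ 1) 1ℤ ∎)
    where
    open ≡-Reasoning
    g = gcd (suc k) n
    1≤g : 1 ≤ g
    1≤g = ℕ.n≢0⇒n>0 (gcd[m,n]≢0 (suc k) n (inj₁ (λ ())))
    g≤n : g ≤ n
    g≤n = ∣⇒≤ {{ℕ.>-nonZero 1≤n}} (gcd[m,n]∣n (suc k) n)

  -- Expand [gcd(k, n) = 1] by Möbius inversion and swap the sums: each d ∣ n divides n / d of the k ≤ n.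
  φ≡id⋆μ : ∀ n → 1 ≤ n → + φ n ≡ (λ d → + d) ⋆μ n
  φ≡id⋆μ n 1≤n = begin
    + φ n
      ≡⟨ length-filter (λ k → gcd (suc k) n ≟ 1) (λ k → k) n ⟩
    ∑ n (λ k → when (gcd (suc k) n ≟ 1) 1ℤ)
      ≡⟨ ∑-cong n (λ k → coprime-indicator n k 1≤n) ⟩
    ∑ n (λ k → ∑ n (λ j → when (suc j ∣? n) (when (suc j ∣? suc k) (μ (suc j)))))
      ≡⟨ ∑-comm n n (λ k j → when (suc j ∣? n) (when (suc j ∣? suc k) (μ (suc j)))) ⟩
    ∑ n (λ j → ∑ n (λ k → when (suc j ∣? n) (when (suc j ∣? suc k) (μ (suc j)))))
      ≡⟨ ∑-cong n (λ j → ∑-when n (suc j ∣? n) (λ k → when (suc j ∣? suc k) (μ (suc j)))) ⟩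
    ∑ n (λ j → when (suc j ∣? n) (∑ n (λ k → when (suc j ∣? suc k) (μ (suc j)))))
      ≡⟨ ∑-cong n (λ j → when-cong-value (suc j ∣? n) (multiples j)) ⟩
    ∑-divisors n (λ d e → + e * μ d)
      ≡⟨ sym (⋆μ-flip (λ d → + d) n) ⟩
    (λ d → + d) ⋆μ n ∎
    where
    open ≡-Reasoning
    multiples : ∀ j → suc j ∣ n → ∑ n (λ k → when (suc j ∣? suc k) (μ (suc j))) ≡ + (n / suc j) * μ (suc j)
    multiples j d∣n = begin
      ∑ n (λ k → when (suc j ∣? suc k) (μ (suc j)))
        ≡⟨ ∑-cong n (λ k → trans (cong (when (suc j ∣? suc k)) (sym (ℤ.*-identityʳ (μ (suc j)))))
                                 (when-* (suc j ∣? suc k) (μ (suc j)) 1ℤ)) ⟩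
      ∑ n (λ k → μ (suc j) * when (suc j ∣? suc k) 1ℤ)
        ≡⟨ ∑-* n (μ (suc j)) _ ⟩
      μ (suc j) * ∑ n (λ k → when (suc j ∣? suc k) 1ℤ)
        ≡⟨ cong (λ z → μ (suc j) * ∑ z (λ k → when (suc j ∣? suc k) 1ℤ)) (sym (m*[n/m]≡n d∣n)) ⟩
      μ (suc j) * ∑ (suc j ℕ.* (n / suc j)) (λ k → when (suc j ∣? suc k) 1ℤ)
        ≡⟨ cong (μ (suc j) *_) (trans (∑-multiples j (n / suc j) (λ _ → 1ℤ)) (∑-1 (n / suc j))) ⟩
      μ (suc j) * + (n / suc j)
        ≡⟨ ℤ.*-comm (μ (suc j)) _ ⟩
      + (n / suc j) * μ (suc j) ∎

  infixr 8 _^ᵢ_ _^ω_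
  _^ᵢ_ : ℤ[i] → ℕ → ℤ[i]
  _^ᵢ_ = powR ℤ[i]Ring
  _^ω_ : ℤ[ω] → ℕ → ℤ[ω]
  _^ω_ = powR ℤ[ω]Ring

  natR-ℤ : ∀ n → natR ℤRing n ≡ + n
  natR-ℤ zero    = refl
  natR-ℤ (suc n) = cong (λ z → 1ℤ + z) (natR-ℤ n)

  intR-ℤ : ∀ z → intR ℤRing z ≡ z
  intR-ℤ (+ n)    = natR-ℤ n
  intR-ℤ -[1+ n ] = cong -_ (natR-ℤ (suc n))

  natR-ℤ[i] : ∀ n → natR ℤ[i]Ring n ≡ ⟨ + n , 0ℤ ⟩ᵢ
  natR-ℤ[i] zero    = refl
  natR-ℤ[i] (suc n) = cong (RawRing._+_ ℤ[i]Ring (RawRing.1# ℤ[i]Ring)) (natR-ℤ[i] n)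

  intR-ℤ[i] : ∀ z → intR ℤ[i]Ring z ≡ ⟨ z , 0ℤ ⟩ᵢ
  intR-ℤ[i] (+ n)    = natR-ℤ[i] n
  intR-ℤ[i] -[1+ n ] = cong (RawRing.-_ ℤ[i]Ring) (natR-ℤ[i] (suc n))

  natR-ℤ[ω] : ∀ n → natR ℤ[ω]Ring n ≡ ⟨ + n , 0ℤ ⟩ω
  natR-ℤ[ω] zero    = refl
  natR-ℤ[ω] (suc n) = cong (RawRing._+_ ℤ[ω]Ring (RawRing.1# ℤ[ω]Ring)) (natR-ℤ[ω] n)

  intR-ℤ[ω] : ∀ z → intR ℤ[ω]Ring z ≡ ⟨ z , 0ℤ ⟩ω
  intR-ℤ[ω] (+ n)    = natR-ℤ[ω] n
  intR-ℤ[ω] -[1+ n ] = cong (RawRing.-_ ℤ[ω]Ring) (natR-ℤ[ω] (suc n))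

  sumR-ℤ[i] : ∀ (F : ℕ → ℤ[i]) xs → sumR ℤ[i]Ring (map F xs) ≡
              ⟨ sumR ℤRing (map (λ x → re (F x)) xs) , sumR ℤRing (map (λ x → im (F x)) xs) ⟩ᵢ
  sumR-ℤ[i] F []       = refl
  sumR-ℤ[i] F (x ∷ xs) = cong (F x +ᵢ_) (sumR-ℤ[i] F xs)

  sumR-ℤ[ω] : ∀ (F : ℕ → ℤ[ω]) xs → sumR ℤ[ω]Ring (map F xs) ≡
              ⟨ sumR ℤRing (map (λ x → re′ (F x)) xs) , sumR ℤRing (map (λ x → om (F x)) xs) ⟩ω
  sumR-ℤ[ω] F []       = refl
  sumR-ℤ[ω] F (x ∷ xs) = cong (F x +ω_) (sumR-ℤ[ω] F xs)

  *ᵢ-scalar : ∀ x z → x *ᵢ natR ℤ[i]Ring 1 *ᵢ intR ℤ[i]Ring z ≡ ⟨ re x * z , im x * z ⟩ᵢ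
  *ᵢ-scalar ⟨ a , b ⟩ᵢ z rewrite intR-ℤ[i] z = cong₂ ⟨_,_⟩ᵢ
    (solve 3 (λ a b z → (a :* con 1ℤ :- b :* con 0ℤ) :* z :- (a :* con 0ℤ :+ b :* con 1ℤ) :* con 0ℤ := a :* z) refl a b z)
    (solve 3 (λ a b z → (a :* con 1ℤ :- b :* con 0ℤ) :* con 0ℤ :+ (a :* con 0ℤ :+ b :* con 1ℤ) :* z := b :* z) refl a b z)

  *ω-scalar : ∀ x z → x *ω natR ℤ[ω]Ring 1 *ω intR ℤ[ω]Ring z ≡ ⟨ re′ x * z , om x * z ⟩ω
  *ω-scalar ⟨ a , b ⟩ω z rewrite intR-ℤ[ω] z = cong₂ ⟨_,_⟩ω
    (solve 3 (λ a b z → (a :* con 1ℤ :- b :* con 0ℤ) :* z :- (a :* con 0ℤ :+ b :* con 1ℤ :- b :* con 0ℤ) :* con 0ℤ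
                        := a :* z) refl a b z)
    (solve 3 (λ a b z → (a :* con 1ℤ :- b :* con 0ℤ) :* con 0ℤ :+ (a :* con 0ℤ :+ b :* con 1ℤ :- b :* con 0ℤ) :* z
                        :- (a :* con 0ℤ :+ b :* con 1ℤ :- b :* con 0ℤ) :* con 0ℤ := b :* z) refl a b z)

  sumR-divisors : ∀ n (F : ℕ → ℤ) (g : ℕ → ℤ) → (∀ j → F j ≡ g (suc j) * μ (n / suc j)) →
                  sumR ℤRing (map F (filter (λ j → suc j ∣? n) (upTo n))) ≡ g ⋆μ n
  sumR-divisors n F g F≡ = trans (sumR-filter (λ j → suc j ∣? n) F (λ j → j) n)
                                 (∑-cong n (λ j → cong (when (suc j ∣? n)) (F≡ j)))

  Jrt-ℤ : ∀ t ζ n → Jrt ℤRing t ζ n ≡ (λ d → powR ℤRing ζ d * + (d ^ t)) ⋆μ n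
  Jrt-ℤ t ζ n = sumR-divisors n _ (λ d → powR ℤRing ζ d * + (d ^ t)) (λ j →
    cong₂ (λ u v → powR ℤRing ζ (suc j) * u * v) (natR-ℤ (suc j ^ t)) (intR-ℤ (μ (n / suc j))))

  Jrt-ℤ[i] : ∀ ζ n → Jrt ℤ[i]Ring 0 ζ n ≡ ⟨ (λ d → re (ζ ^ᵢ d)) ⋆μ n , (λ d → im (ζ ^ᵢ d)) ⋆μ n ⟩ᵢ
  Jrt-ℤ[i] ζ n = trans (sumR-ℤ[i] _ (filter (λ j → suc j ∣? n) (upTo n))) (cong₂ ⟨_,_⟩ᵢ
    (sumR-divisors n _ (λ d → re (ζ ^ᵢ d)) (λ j → cong re (*ᵢ-scalar (ζ ^ᵢ suc j) (μ (n / suc j)))))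
    (sumR-divisors n _ (λ d → im (ζ ^ᵢ d)) (λ j → cong im (*ᵢ-scalar (ζ ^ᵢ suc j) (μ (n / suc j))))))

  Jrt-ℤ[ω] : ∀ ζ n → Jrt ℤ[ω]Ring 0 ζ n ≡ ⟨ (λ d → re′ (ζ ^ω d)) ⋆μ n , (λ d → om (ζ ^ω d)) ⋆μ n ⟩ω
  Jrt-ℤ[ω] ζ n = trans (sumR-ℤ[ω] _ (filter (λ j → suc j ∣? n) (upTo n))) (cong₂ ⟨_,_⟩ω
    (sumR-divisors n _ (λ d → re′ (ζ ^ω d)) (λ j → cong re′ (*ω-scalar (ζ ^ω suc j) (μ (n / suc j)))))
    (sumR-divisors n _ (λ d → om (ζ ^ω d)) (λ j → cong om (*ω-scalar (ζ ^ω suc j) (μ (n / suc j))))))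

  -- Powers of roots of unity

  powR-mod : ∀ (R : RawRing 0ℓ 0ℓ) ζ k .{{_ : NonZero k}} → (∀ d → powR R ζ (k ℕ.+ d) ≡ powR R ζ d) →
             ∀ d → powR R ζ d ≡ powR R ζ (d % k)
  powR-mod R ζ k period d =
    trans (cong (powR R ζ) (trans (m≡m%n+[m/n]*n d k) (ℕ.+-comm (d % k) _))) (drop-periods (d / k) (d % k))
    where
    drop-periods : ∀ q r → powR R ζ (q ℕ.* k ℕ.+ r) ≡ powR R ζ r
    drop-periods zero    r = refl
    drop-periods (suc q) r = trans (cong (powR R ζ) (ℕ.+-assoc k (q ℕ.* k) r)) (trans (period _) (drop-periods q r))

  powR-ℤ : ∀ x n → powR ℤRing x n ≡ x ℤ.^ n
  powR-ℤ x zero    = refl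
  powR-ℤ x (suc n) = cong (x *_) (powR-ℤ x n)

  -1^even : ∀ x → powR ℤRing (- 1ℤ) (2 ℕ.* x) ≡ 1ℤ
  -1^even x = trans (powR-ℤ (- 1ℤ) (2 ℕ.* x)) (trans (sym (ℤ.^-*-assoc (- 1ℤ) 2 x)) (ℤ.^-zeroˡ x))

  -1^odd : ∀ d → ¬ 2 ∣ d → powR ℤRing (- 1ℤ) d ≡ - 1ℤ
  -1^odd d 2∤d = begin
    powR ℤRing (- 1ℤ) d
      ≡⟨ cong (powR ℤRing (- 1ℤ)) (m≡m%n+[m/n]*n d 2) ⟩
    powR ℤRing (- 1ℤ) (d % 2 ℕ.+ d / 2 ℕ.* 2)
      ≡⟨ cong (λ r → powR ℤRing (- 1ℤ) (r ℕ.+ d / 2 ℕ.* 2)) d%2≡1 ⟩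
    - 1ℤ * powR ℤRing (- 1ℤ) (d / 2 ℕ.* 2)
      ≡⟨ cong (λ e → - 1ℤ * powR ℤRing (- 1ℤ) e) (ℕ.*-comm (d / 2) 2) ⟩
    - 1ℤ * powR ℤRing (- 1ℤ) (2 ℕ.* (d / 2))
      ≡⟨ cong (- 1ℤ *_) (-1^even (d / 2)) ⟩
    - 1ℤ ∎
    where
    open ≡-Reasoning
    d%2≡1 : d % 2 ≡ 1
    d%2≡1 with d % 2 | m%n<n d 2 | m%n≡0⇒n∣m d 2
    ... | zero      | _               | 2∣ = ⊥-elim (2∤d (2∣ refl))
    ... | suc zero  | _               | _  = refl
    ... | suc (suc _) | s≤s (s≤s ())  | _

  χ₄ᵣ ψ₄ᵣ : ℕ → ℤ
  χ₄ᵣ 1 = 1ℤ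
  χ₄ᵣ 3 = - 1ℤ
  χ₄ᵣ _ = 0ℤ
  ψ₄ᵣ 0 = 1ℤ
  ψ₄ᵣ 2 = - 1ℤ
  ψ₄ᵣ _ = 0ℤ

  -- χ₄ is the non-principal Dirichlet character mod 4; i^d = ψ₄ d + χ₄ d i.
  χ₄ ψ₄ : ℕ → ℤ
  χ₄ d = χ₄ᵣ (d % 4)
  ψ₄ d = ψ₄ᵣ (d % 4)

  odd-residue-mod-4 : ∀ d → ¬ 2 ∣ d → d % 4 ≡ 1 ⊎ d % 4 ≡ 3
  odd-residue-mod-4 d 2∤d = go (d % 4) (m%n<n d 4) (λ 2∣r → 2∤d (∣n∣m%n⇒∣m (divides 2 refl) 2∣r))
    where
    go : ∀ r → r < 4 → ¬ 2 ∣ r → r ≡ 1 ⊎ r ≡ 3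
    go 0 _ 2∤r = ⊥-elim (2∤r (divides 0 refl))
    go 1 _ _   = inj₁ refl
    go 2 _ 2∤r = ⊥-elim (2∤r ∣-refl)
    go 3 _ _   = inj₂ refl
    go (suc (suc (suc (suc _)))) (s≤s (s≤s (s≤s (s≤s ())))) _

  χ₄-* : ∀ a b → χ₄ (a ℕ.* b) ≡ χ₄ a * χ₄ b
  χ₄-* a b = trans (cong χ₄ᵣ (%-distribˡ-* a b 4)) (table (a % 4) (b % 4) (m%n<n a 4) (m%n<n b 4))
    where
    table : ∀ r q → r < 4 → q < 4 → χ₄ᵣ ((r ℕ.* q) % 4) ≡ χ₄ᵣ r * χ₄ᵣ q
    table 0 0 _ _ = refl
    table 0 1 _ _ = refl
    table 0 2 _ _ = refl
    table 0 3 _ _ = refl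
    table 1 0 _ _ = refl
    table 1 1 _ _ = refl
    table 1 2 _ _ = refl
    table 1 3 _ _ = refl
    table 2 0 _ _ = refl
    table 2 1 _ _ = refl
    table 2 2 _ _ = refl
    table 2 3 _ _ = refl
    table 3 0 _ _ = refl
    table 3 1 _ _ = refl
    table 3 2 _ _ = refl
    table 3 3 _ _ = refl
    table (suc (suc (suc (suc _)))) _ (s≤s (s≤s (s≤s (s≤s ())))) _
    table _ (suc (suc (suc (suc _)))) _ (s≤s (s≤s (s≤s (s≤s ()))))

  ψ₄-odd : ∀ d → ¬ 2 ∣ d → ψ₄ d ≡ 0ℤ
  ψ₄-odd d 2∤d with odd-residue-mod-4 d 2∤d
  ... | inj₁ r≡1 = cong ψ₄ᵣ r≡1
  ... | inj₂ r≡3 = cong ψ₄ᵣ r≡3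

  ψ₄-2*odd : ∀ d → ¬ 2 ∣ d → ψ₄ (2 ℕ.* d) ≡ - 1ℤ
  ψ₄-2*odd d 2∤d = trans (cong ψ₄ᵣ (%-distribˡ-* 2 d 4)) (by-residue (d % 4) (odd-residue-mod-4 d 2∤d))
    where
    by-residue : ∀ r → r ≡ 1 ⊎ r ≡ 3 → ψ₄ᵣ ((2 ℕ.* r) % 4) ≡ - 1ℤ
    by-residue _ (inj₁ refl) = refl
    by-residue _ (inj₂ refl) = refl

  ψ₄-4* : ∀ x → ψ₄ (4 ℕ.* x) ≡ 1ℤ
  ψ₄-4* x = cong ψ₄ᵣ (trans (cong (_% 4) (ℕ.*-comm 4 x)) (m*n%n≡0 x 4))

  half-turn : ∀ s → s * s ≡ 1ℤ → ∀ a b →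
              ⟨ 0ℤ , s ⟩ᵢ *ᵢ (⟨ 0ℤ , s ⟩ᵢ *ᵢ ⟨ a , b ⟩ᵢ) ≡ ⟨ - a , - b ⟩ᵢ
  half-turn s s²≡1 a b = cong₂ ⟨_,_⟩ᵢ
    (trans (solve 3 (λ s a b → con 0ℤ :* (con 0ℤ :* a :- s :* b) :- s :* (con 0ℤ :* b :+ s :* a) := :- (s :* s :* a)) refl s a b)
           (trans (cong (λ t → - (t * a)) s²≡1) (cong -_ (ℤ.*-identityˡ a))))
    (trans (solve 3 (λ s a b → con 0ℤ :* (con 0ℤ :* b :+ s :* a) :+ s :* (con 0ℤ :* a :- s :* b) := :- (s :* s :* b)) refl s a b)
           (trans (cong (λ t → - (t * b)) s²≡1) (cong -_ (ℤ.*-identityˡ b))))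

  full-turn : ∀ s → s * s ≡ 1ℤ → ∀ x →
              ⟨ 0ℤ , s ⟩ᵢ *ᵢ (⟨ 0ℤ , s ⟩ᵢ *ᵢ (⟨ 0ℤ , s ⟩ᵢ *ᵢ (⟨ 0ℤ , s ⟩ᵢ *ᵢ x))) ≡ x
  full-turn s s²≡1 ⟨ a , b ⟩ᵢ = begin
    u *ᵢ (u *ᵢ (u *ᵢ (u *ᵢ ⟨ a , b ⟩ᵢ))) ≡⟨ cong (λ y → u *ᵢ (u *ᵢ y)) (half-turn s s²≡1 a b) ⟩
    u *ᵢ (u *ᵢ ⟨ - a , - b ⟩ᵢ)           ≡⟨ half-turn s s²≡1 (- a) (- b) ⟩
    ⟨ - - a , - - b ⟩ᵢ                   ≡⟨ cong₂ ⟨_,_⟩ᵢ (ℤ.neg-involutive a) (ℤ.neg-involutive b) ⟩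
    ⟨ a , b ⟩ᵢ                           ∎
    where
    open ≡-Reasoning
    u = ⟨ 0ℤ , s ⟩ᵢ

  𝕚^k^ : ∀ {k} → k ≡ 1 ⊎ k ≡ 3 → ∀ d → (𝕚 ^ᵢ k) ^ᵢ d ≡ ⟨ ψ₄ d , χ₄ k * χ₄ d ⟩ᵢ
  𝕚^k^ k≡ d = trans (powR-mod ℤ[i]Ring _ 4 (period k≡) d) (table k≡ (d % 4) (m%n<n d 4))
    where
    period : ∀ {k} → k ≡ 1 ⊎ k ≡ 3 → ∀ d → (𝕚 ^ᵢ k) ^ᵢ (4 ℕ.+ d) ≡ (𝕚 ^ᵢ k) ^ᵢ d
    period (inj₁ refl) d = full-turn 1ℤ refl _
    period (inj₂ refl) d = full-turn (- 1ℤ) refl _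
    table : ∀ {k} → k ≡ 1 ⊎ k ≡ 3 → ∀ r → r < 4 → (𝕚 ^ᵢ k) ^ᵢ r ≡ ⟨ ψ₄ᵣ r , χ₄ k * χ₄ᵣ r ⟩ᵢ
    table (inj₁ refl) 0 _ = refl
    table (inj₁ refl) 1 _ = refl
    table (inj₁ refl) 2 _ = refl
    table (inj₁ refl) 3 _ = refl
    table (inj₂ refl) 0 _ = refl
    table (inj₂ refl) 1 _ = refl
    table (inj₂ refl) 2 _ = refl
    table (inj₂ refl) 3 _ = refl
    table _ (suc (suc (suc (suc _)))) (s≤s (s≤s (s≤s (s≤s ()))))

  χ₃ᵣ : ℕ → ℤ
  χ₃ᵣ 1 = 1ℤ
  χ₃ᵣ 2 = - 1ℤ
  χ₃ᵣ _ = 0ℤ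

  -- The non-principal Dirichlet character mod 3; it is the ω-coordinate of ω^d in the basis (1, ω).
  χ₃ : ℕ → ℤ
  χ₃ d = χ₃ᵣ (d % 3)

  residue-mod-3 : ∀ d → ¬ 3 ∣ d → d % 3 ≡ 1 ⊎ d % 3 ≡ 2
  residue-mod-3 d 3∤d = go (d % 3) (m%n<n d 3) refl
    where
    go : ∀ r → r < 3 → d % 3 ≡ r → r ≡ 1 ⊎ r ≡ 2
    go 0 _ d%3≡0 = ⊥-elim (3∤d (m%n≡0⇒n∣m d 3 d%3≡0))
    go 1 _ _     = inj₁ refl
    go 2 _ _     = inj₂ refl
    go (suc (suc (suc _))) (s≤s (s≤s (s≤s ()))) _

  χ₃-* : ∀ a b → χ₃ (a ℕ.* b) ≡ χ₃ a * χ₃ b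
  χ₃-* a b = trans (cong χ₃ᵣ (%-distribˡ-* a b 3)) (table (a % 3) (b % 3) (m%n<n a 3) (m%n<n b 3))
    where
    table : ∀ r q → r < 3 → q < 3 → χ₃ᵣ ((r ℕ.* q) % 3) ≡ χ₃ᵣ r * χ₃ᵣ q
    table 0 0 _ _ = refl
    table 0 1 _ _ = refl
    table 0 2 _ _ = refl
    table 1 0 _ _ = refl
    table 1 1 _ _ = refl
    table 1 2 _ _ = refl
    table 2 0 _ _ = refl
    table 2 1 _ _ = refl
    table 2 2 _ _ = refl
    table (suc (suc (suc _))) _ (s≤s (s≤s (s≤s ()))) _
    table _ (suc (suc (suc _))) _ (s≤s (s≤s (s≤s ())))

  ω-turn : ∀ a b → ω₃ *ω ⟨ a , b ⟩ω ≡ ⟨ - b , a - b ⟩ω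
  ω-turn a b = cong₂ ⟨_,_⟩ω (solve 2 (λ a b → con 0ℤ :* a :- con 1ℤ :* b := :- b) refl a b)
                            (solve 2 (λ a b → con 0ℤ :* b :+ con 1ℤ :* a :- con 1ℤ :* b := a :- b) refl a b)

  ω²-turn : ∀ a b → ⟨ - 1ℤ , - 1ℤ ⟩ω *ω ⟨ a , b ⟩ω ≡ ⟨ b - a , - a ⟩ω
  ω²-turn a b = cong₂ ⟨_,_⟩ω (solve 2 (λ a b → con (- 1ℤ) :* a :- con (- 1ℤ) :* b := b :- a) refl a b)
                             (solve 2 (λ a b → con (- 1ℤ) :* b :+ con (- 1ℤ) :* a :- con (- 1ℤ) :* b := :- a) refl a b)

  ω-cube : ∀ x → ω₃ *ω (ω₃ *ω (ω₃ *ω x)) ≡ x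
  ω-cube ⟨ a , b ⟩ω = begin
    ω₃ *ω (ω₃ *ω (ω₃ *ω ⟨ a , b ⟩ω))                       ≡⟨ cong (λ y → ω₃ *ω (ω₃ *ω y)) (ω-turn a b) ⟩
    ω₃ *ω (ω₃ *ω ⟨ - b , a - b ⟩ω)                         ≡⟨ cong (ω₃ *ω_) (ω-turn (- b) (a - b)) ⟩
    ω₃ *ω ⟨ - (a - b) , - b - (a - b) ⟩ω                   ≡⟨ ω-turn (- (a - b)) (- b - (a - b)) ⟩
    ⟨ - (- b - (a - b)) , - (a - b) - (- b - (a - b)) ⟩ω   ≡⟨ cong₂ ⟨_,_⟩ω
        (solve 2 (λ a b → :- (:- b :- (a :- b)) := a) refl a b)
        (solve 2 (λ a b → :- (a :- b) :- (:- b :- (a :- b)) := b) refl a b) ⟩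
    ⟨ a , b ⟩ω                                             ∎
    where open ≡-Reasoning

  ω²-cube : ∀ x → ⟨ - 1ℤ , - 1ℤ ⟩ω *ω (⟨ - 1ℤ , - 1ℤ ⟩ω *ω (⟨ - 1ℤ , - 1ℤ ⟩ω *ω x)) ≡ x
  ω²-cube ⟨ a , b ⟩ω = begin
    u *ω (u *ω (u *ω ⟨ a , b ⟩ω))                          ≡⟨ cong (λ y → u *ω (u *ω y)) (ω²-turn a b) ⟩
    u *ω (u *ω ⟨ b - a , - a ⟩ω)                           ≡⟨ cong (u *ω_) (ω²-turn (b - a) (- a)) ⟩
    u *ω ⟨ - a - (b - a) , - (b - a) ⟩ω                    ≡⟨ ω²-turn (- a - (b - a)) (- (b - a)) ⟩
    ⟨ - (b - a) - (- a - (b - a)) , - (- a - (b - a)) ⟩ω   ≡⟨ cong₂ ⟨_,_⟩ω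
        (solve 2 (λ a b → :- (b :- a) :- (:- a :- (b :- a)) := a) refl a b)
        (solve 2 (λ a b → :- (:- a :- (b :- a)) := b) refl a b) ⟩
    ⟨ a , b ⟩ω                                             ∎
    where
    open ≡-Reasoning
    u = ⟨ - 1ℤ , - 1ℤ ⟩ω

  ω^k^-mod-3 : ∀ {k} → k ≡ 1 ⊎ k ≡ 2 → ∀ d → (ω₃ ^ω k) ^ω d ≡ (ω₃ ^ω k) ^ω (d % 3)
  ω^k^-mod-3 (inj₁ refl) = powR-mod ℤ[ω]Ring _ 3 (λ _ → ω-cube _)
  ω^k^-mod-3 (inj₂ refl) = powR-mod ℤ[ω]Ring _ 3 (λ _ → ω²-cube _)

  om-ω^k^ : ∀ {k} → k ≡ 1 ⊎ k ≡ 2 → ∀ d → om ((ω₃ ^ω k) ^ω d) ≡ χ₃ k * χ₃ d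
  om-ω^k^ k≡ d = trans (cong om (ω^k^-mod-3 k≡ d)) (table k≡ (d % 3) (m%n<n d 3))
    where
    table : ∀ {k} → k ≡ 1 ⊎ k ≡ 2 → ∀ r → r < 3 → om ((ω₃ ^ω k) ^ω r) ≡ χ₃ k * χ₃ᵣ r
    table (inj₁ refl) 0 _ = refl
    table (inj₁ refl) 1 _ = refl
    table (inj₁ refl) 2 _ = refl
    table (inj₂ refl) 0 _ = refl
    table (inj₂ refl) 1 _ = refl
    table (inj₂ refl) 2 _ = refl
    table _ (suc (suc (suc _))) (s≤s (s≤s (s≤s ())))

  -- ζ^d is ω = 0 + 1 ω or ω² = -1 - ω when 3 ∤ d, so its coordinates a + b ω satisfy 2 a = b - 1.
  re′-ω^k^-3∤ : ∀ {k} → k ≡ 1 ⊎ k ≡ 2 → ∀ d → ¬ 3 ∣ d →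
                + 2 * re′ ((ω₃ ^ω k) ^ω d) ≡ χ₃ k * χ₃ d - 1ℤ
  re′-ω^k^-3∤ k≡ d 3∤d =
    trans (cong (λ z → + 2 * re′ z) (ω^k^-mod-3 k≡ d)) (by-residue k≡ (d % 3) (residue-mod-3 d 3∤d))
    where
    by-residue : ∀ {k} → k ≡ 1 ⊎ k ≡ 2 → ∀ r → r ≡ 1 ⊎ r ≡ 2 →
                 + 2 * re′ ((ω₃ ^ω k) ^ω r) ≡ χ₃ k * χ₃ᵣ r - 1ℤ
    by-residue (inj₁ refl) _ (inj₁ refl) = refl
    by-residue (inj₁ refl) _ (inj₂ refl) = refl
    by-residue (inj₂ refl) _ (inj₁ refl) = refl
    by-residue (inj₂ refl) _ (inj₂ refl) = refl

  re′-ω^k^-3^suc* : ∀ {k} → k ≡ 1 ⊎ k ≡ 2 → ∀ b d → re′ ((ω₃ ^ω k) ^ω (3 ^ suc b ℕ.* d)) ≡ 1ℤ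
  re′-ω^k^-3^suc* {k} k≡ b d = trans (cong re′ (ω^k^-mod-3 k≡ (3 ^ suc b ℕ.* d)))
    (cong (λ r → re′ ((ω₃ ^ω k) ^ω r)) 3∣)
    where
    3∣ : (3 ^ suc b ℕ.* d) % 3 ≡ 0
    3∣ = trans (cong (_% 3) (trans (ℕ.*-assoc 3 (3 ^ b) d) (ℕ.*-comm 3 (3 ^ b ℕ.* d)))) (m*n%n≡0 (3 ^ b ℕ.* d) 3)

  -- (i) and (ii): ζ = -1

  2∤2⁰*divisor : ∀ {m d} → ¬ 2 ∣ m → d ∣ m → ¬ 2 ∣ 2 ^ 0 ℕ.* d
  2∤2⁰*divisor {d = d} 2∤m d∣m = subst (λ x → ¬ 2 ∣ x) (sym (ℕ.*-identityˡ d)) (∤-divisor 2∤m d∣m)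

  2^suc* : ∀ b d → 2 ^ suc b ℕ.* d ≡ 2 ℕ.* (2 ^ b ℕ.* d)
  2^suc* b d = ℕ.*-assoc 2 (2 ^ b) d

  -1^[2^suc*] : ∀ b d → powR ℤRing (- 1ℤ) (2 ^ suc b ℕ.* d) ≡ 1ℤ
  -1^[2^suc*] b d = trans (cong (powR ℤRing (- 1ℤ)) (2^suc* b d)) (-1^even (2 ^ b ℕ.* d))

  alternating : ℕ → ℕ → ℤ
  alternating t d = powR ℤRing (- 1ℤ) d * + (d ^ t)

  alternating-even : ∀ t b d → alternating t (2 ^ suc b ℕ.* d) ≡ + ((2 ^ suc b ℕ.* d) ^ t)
  alternating-even t b d = trans (cong (_* + ((2 ^ suc b ℕ.* d) ^ t)) (-1^[2^suc*] b d)) (ℤ.*-identityˡ _)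

  alternating-odd : ∀ t d → ¬ 2 ∣ d → alternating t d ≡ - + (d ^ t)
  alternating-odd t d 2∤d = trans (cong (_* + (d ^ t)) (-1^odd d 2∤d)) (ℤ.-1*i≡-i _)

  alternating-2⁰* : ∀ t m d → ¬ 2 ∣ m → d ∣ m → alternating t (2 ^ 0 ℕ.* d) ≡ - + ((2 ^ 0 ℕ.* d) ^ t)
  alternating-2⁰* t m d 2∤m d∣m = alternating-odd t (2 ^ 0 ℕ.* d) (2∤2⁰*divisor 2∤m d∣m)

  J[0,-1]-vanishes : ∀ n → 2 < n → alternating 0 ⋆μ n ≡ 0ℤ
  J[0,-1]-vanishes n 2<n = by-cases (2 ∣? n)
    where
    1≤n = ℕ.≤-trans (s≤s z≤n) (ℕ.<⇒≤ 2<n)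
    even-case : ∀ b m → n ≡ 2 ^ suc b ℕ.* m → ¬ 2 ∣ m → 1 ≤ m → alternating 0 ⋆μ n ≡ 0ℤ
    even-case zero m n≡ 2∤m 1≤m =
      trans (cong (alternating 0 ⋆μ_) n≡) (trans (⋆μ-peel 2 0 m (alternating 0) prime[2] 1≤m 2∤m)
        (trans (⋆μ-cong m (λ d d∣m → cong₂ _-_ (alternating-even 0 0 d) (alternating-2⁰* 0 m d 2∤m d∣m)))
               (const⋆μ≡0 (+ 2) m 2≤m)))
      where
      2≤m : 2 ≤ m
      2≤m = ℕ.≤∧≢⇒< 1≤m (λ { refl → ℕ.<⇒≢ 2<n (sym n≡) })
    even-case (suc b) m n≡ 2∤m 1≤m =
      trans (cong (alternating 0 ⋆μ_) n≡) (trans (⋆μ-peel 2 (suc b) m (alternating 0) prime[2] 1≤m 2∤m)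
        (⋆μ-zero m (λ d _ → cong₂ _-_ (alternating-even 0 (suc b) d) (alternating-even 0 b d))))
    by-cases : Dec (2 ∣ n) → alternating 0 ⋆μ n ≡ 0ℤ
    by-cases (no 2∤n) = trans (⋆μ-cong n (λ d d∣n → alternating-odd 0 d (∤-divisor 2∤n d∣n)))
                              (const⋆μ≡0 (- 1ℤ) n (ℕ.<⇒≤ 2<n))
    by-cases (yes 2∣n) with factor-prime-power n 2 prime[2] 1≤n 2∣n
    ... | b , m , n≡ , 2∤m , 1≤m = even-case b m n≡ 2∤m 1≤m

  part-i : (n : ℕ) → 1 ≤ n →
      (n ≡ 1 → Jrt ℤRing 0 (- 1ℤ) n ≡ -[1+ 0 ])
    × (n ≡ 2 → Jrt ℤRing 0 (- 1ℤ) n ≡ + 2)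
    × (2 < n → Jrt ℤRing 0 (- 1ℤ) n ≡ + 0)
  part-i n _ = (λ { refl → refl }) , (λ { refl → refl }) , λ 2<n → trans (Jrt-ℤ 0 (- 1ℤ) n) (J[0,-1]-vanishes n 2<n)

  J[1,-1]-odd : ∀ m → ¬ 2 ∣ m → alternating 1 ⋆μ m ≡ - + φ m
  J[1,-1]-odd m 2∤m = begin
    alternating 1 ⋆μ m               ≡⟨ ⋆μ-cong m (λ d d∣m → trans (alternating-odd 1 d (∤-divisor 2∤m d∣m))
                                                                  (sym (ℤ.-1*i≡-i (+ (d ^ 1))))) ⟩
    (λ d → - 1ℤ * + (d ^ 1)) ⋆μ m    ≡⟨ ⋆μ-* m (- 1ℤ) (λ d → + (d ^ 1)) ⟩
    - 1ℤ * (λ d → + (d ^ 1)) ⋆μ m    ≡⟨ cong (λ x → - 1ℤ * x) (⋆μ-cong m (λ d _ → cong +_ (ℕ.*-identityʳ d))) ⟩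
    - 1ℤ * (λ d → + d) ⋆μ m          ≡⟨ cong (λ x → - 1ℤ * x) (sym (φ≡id⋆μ m (∤⇒1≤ 2∤m))) ⟩
    - 1ℤ * + φ m                     ≡⟨ ℤ.-1*i≡-i _ ⟩
    - + φ m                          ∎
    where open ≡-Reasoning

  -- For odd d, (-1)^(2d) 2d - (-1)^d d = 3 (2d - d): peeling 2 turns the weight into 3 times that of φ.
  J[1,-1]-2*odd : ∀ m → ¬ 2 ∣ m → alternating 1 ⋆μ (2 ^ 1 ℕ.* m) ≡ + (3 ℕ.* φ (2 ^ 1 ℕ.* m))
  J[1,-1]-2*odd m 2∤m = begin
    alternating 1 ⋆μ (2 ^ 1 ℕ.* m)
      ≡⟨ ⋆μ-peel 2 0 m (alternating 1) prime[2] 1≤m 2∤m ⟩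
    (λ d → alternating 1 (2 ^ 1 ℕ.* d) - alternating 1 (2 ^ 0 ℕ.* d)) ⋆μ m
      ≡⟨ ⋆μ-cong m (λ d d∣m → difference d d∣m) ⟩
    (λ d → + 3 * (+ (2 ^ 1 ℕ.* d) - + (2 ^ 0 ℕ.* d))) ⋆μ m
      ≡⟨ ⋆μ-* m (+ 3) (λ d → + (2 ^ 1 ℕ.* d) - + (2 ^ 0 ℕ.* d)) ⟩
    + 3 * (λ d → + (2 ^ 1 ℕ.* d) - + (2 ^ 0 ℕ.* d)) ⋆μ m
      ≡⟨ cong (+ 3 *_) (sym (⋆μ-peel 2 0 m +_ prime[2] 1≤m 2∤m)) ⟩
    + 3 * (+_) ⋆μ (2 ^ 1 ℕ.* m)
      ≡⟨ cong (+ 3 *_) (sym (φ≡id⋆μ (2 ^ 1 ℕ.* m) (ℕ.≤-trans 1≤m (n≤m*n {2 ^ 1} m (s≤s z≤n))))) ⟩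
    + 3 * + φ (2 ^ 1 ℕ.* m)
      ≡⟨ sym (ℤ.pos-* 3 (φ (2 ^ 1 ℕ.* m))) ⟩
    + (3 ℕ.* φ (2 ^ 1 ℕ.* m)) ∎
    where
    open ≡-Reasoning
    1≤m = ∤⇒1≤ 2∤m
    difference : ∀ d → d ∣ m → alternating 1 (2 ^ 1 ℕ.* d) - alternating 1 (2 ^ 0 ℕ.* d)
                               ≡ + 3 * (+ (2 ^ 1 ℕ.* d) - + (2 ^ 0 ℕ.* d))
    difference d d∣m = begin
      alternating 1 (2 ^ 1 ℕ.* d) - alternating 1 (2 ^ 0 ℕ.* d)
        ≡⟨ cong₂ _-_ (trans (alternating-even 1 0 d) (cong +_ (ℕ.*-identityʳ (2 ^ 1 ℕ.* d))))
                     (trans (alternating-2⁰* 1 m d 2∤m d∣m) (cong (λ x → - + x) (ℕ.*-identityʳ (2 ^ 0 ℕ.* d)))) ⟩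
      + (2 ^ 1 ℕ.* d) - - + (2 ^ 0 ℕ.* d)
        ≡⟨ cong (λ x → x - - + (2 ^ 0 ℕ.* d)) twice ⟩
      + 2 * + (2 ^ 0 ℕ.* d) - - + (2 ^ 0 ℕ.* d)
        ≡⟨ solve 1 (λ x → con (+ 2) :* x :- :- x := con (+ 3) :* (con (+ 2) :* x :- x)) refl (+ (2 ^ 0 ℕ.* d)) ⟩
      + 3 * (+ 2 * + (2 ^ 0 ℕ.* d) - + (2 ^ 0 ℕ.* d))
        ≡⟨ cong (λ x → + 3 * (x - + (2 ^ 0 ℕ.* d))) (sym twice) ⟩
      + 3 * (+ (2 ^ 1 ℕ.* d) - + (2 ^ 0 ℕ.* d)) ∎
      where
      twice : + (2 ^ 1 ℕ.* d) ≡ + 2 * + (2 ^ 0 ℕ.* d)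
      twice = trans (cong +_ (2^suc* 0 d)) (ℤ.pos-* 2 (2 ^ 0 ℕ.* d))

  J[1,-1]-4∣ : ∀ b m → ¬ 2 ∣ m → alternating 1 ⋆μ (2 ^ suc (suc b) ℕ.* m) ≡ + φ (2 ^ suc (suc b) ℕ.* m)
  J[1,-1]-4∣ b m 2∤m = begin
    alternating 1 ⋆μ n
      ≡⟨ ⋆μ-peel 2 (suc b) m (alternating 1) prime[2] 1≤m 2∤m ⟩
    (λ d → alternating 1 (2 ^ suc (suc b) ℕ.* d) - alternating 1 (2 ^ suc b ℕ.* d)) ⋆μ m
      ≡⟨ ⋆μ-cong m (λ d _ → cong₂ _-_ (even (suc b) d) (even b d)) ⟩
    (λ d → + (2 ^ suc (suc b) ℕ.* d) - + (2 ^ suc b ℕ.* d)) ⋆μ m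
      ≡⟨ sym (⋆μ-peel 2 (suc b) m +_ prime[2] 1≤m 2∤m) ⟩
    (+_) ⋆μ n
      ≡⟨ sym (φ≡id⋆μ n (ℕ.≤-trans 1≤m (n≤m*n m (1≤^ (suc (suc b)) (s≤s z≤n))))) ⟩
    + φ n ∎
    where
    open ≡-Reasoning
    n = 2 ^ suc (suc b) ℕ.* m
    1≤m = ∤⇒1≤ 2∤m
    even : ∀ k d → alternating 1 (2 ^ suc k ℕ.* d) ≡ + (2 ^ suc k ℕ.* d)
    even k d = trans (alternating-even 1 k d) (cong +_ (ℕ.*-identityʳ _))

  part-ii : (n a m : ℕ) → n ≡ 2 ^ a ℕ.* m → m % 2 ≡ 1 →
      (a ≡ 0 → Jrt ℤRing 1 (- 1ℤ) n ≡ - (+ φ n))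
    × (a ≡ 1 → Jrt ℤRing 1 (- 1ℤ) n ≡ + (3 ℕ.* φ n))
    × (2 ≤ a → Jrt ℤRing 1 (- 1ℤ) n ≡ + φ n)
  part-ii _ zero m refl m-odd =
      (λ _ → trans (Jrt-ℤ 1 (- 1ℤ) (2 ^ 0 ℕ.* m))
                   (subst (λ x → alternating 1 ⋆μ x ≡ - + φ x) (sym (ℕ.*-identityˡ m)) (J[1,-1]-odd m (odd⇒2∤ m m-odd))))
    , (λ ()) , λ ()
  part-ii _ (suc zero) m refl m-odd =
    (λ ()) , (λ _ → trans (Jrt-ℤ 1 (- 1ℤ) (2 ^ 1 ℕ.* m)) (J[1,-1]-2*odd m (odd⇒2∤ m m-odd))) , λ { (s≤s ()) }
  part-ii _ (suc (suc b)) m refl m-odd =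
    (λ ()) , (λ ()) , λ _ → trans (Jrt-ℤ 1 (- 1ℤ) (2 ^ suc (suc b) ℕ.* m)) (J[1,-1]-4∣ b m (odd⇒2∤ m m-odd))

  -- (iii): ζ = ± i

  module Χ₄ = CompletelyMultiplicative χ₄ χ₄-* refl

  ψ₄-2^2+* : ∀ b d → ψ₄ (2 ^ suc (suc b) ℕ.* d) ≡ 1ℤ
  ψ₄-2^2+* b d = trans (cong ψ₄ (trans (cong (ℕ._* d) (sym (ℕ.*-assoc 2 2 (2 ^ b)))) (ℕ.*-assoc 4 (2 ^ b) d)))
                       (ψ₄-4* (2 ^ b ℕ.* d))

  ψ₄-2⁰*odd : ∀ m d → ¬ 2 ∣ m → d ∣ m → ψ₄ (2 ^ 0 ℕ.* d) ≡ 0ℤ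
  ψ₄-2⁰*odd m d 2∤m d∣m = ψ₄-odd (2 ^ 0 ℕ.* d) (2∤2⁰*divisor 2∤m d∣m)

  ψ₄-2¹*odd : ∀ m d → ¬ 2 ∣ m → d ∣ m → ψ₄ (2 ^ 1 ℕ.* d) ≡ - 1ℤ
  ψ₄-2¹*odd m d 2∤m d∣m = trans (cong ψ₄ (2^suc* 0 d)) (ψ₄-2*odd (2 ^ 0 ℕ.* d) (2∤2⁰*divisor 2∤m d∣m))

  ψ₄⋆μ≡0 : ∀ a m → ¬ 2 ∣ m → (a ≡ 1 ⊎ a ≡ 2 → 2 ≤ m) → ψ₄ ⋆μ (2 ^ a ℕ.* m) ≡ 0ℤ
  ψ₄⋆μ≡0 zero m 2∤m _ =
    trans (cong (ψ₄ ⋆μ_) (ℕ.*-identityˡ m)) (⋆μ-zero m (λ d d∣m → ψ₄-odd d (∤-divisor 2∤m d∣m)))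
  ψ₄⋆μ≡0 (suc zero) m 2∤m 2≤m = trans (⋆μ-peel 2 0 m ψ₄ prime[2] (∤⇒1≤ 2∤m) 2∤m)
    (trans (⋆μ-cong m (λ d d∣m → cong₂ _-_ (ψ₄-2¹*odd m d 2∤m d∣m) (ψ₄-2⁰*odd m d 2∤m d∣m)))
           (const⋆μ≡0 (- 1ℤ) m (2≤m (inj₁ refl))))
  ψ₄⋆μ≡0 (suc (suc zero)) m 2∤m 2≤m = trans (⋆μ-peel 2 1 m ψ₄ prime[2] (∤⇒1≤ 2∤m) 2∤m)
    (trans (⋆μ-cong m (λ d d∣m → cong₂ _-_ (ψ₄-2^2+* 0 d) (ψ₄-2¹*odd m d 2∤m d∣m)))
           (const⋆μ≡0 (+ 2) m (2≤m (inj₂ refl))))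
  ψ₄⋆μ≡0 (suc (suc (suc b))) m 2∤m _ = trans (⋆μ-peel 2 (suc (suc b)) m ψ₄ prime[2] (∤⇒1≤ 2∤m) 2∤m)
    (⋆μ-zero m (λ d _ → cong₂ _-_ (ψ₄-2^2+* (suc b) d) (ψ₄-2^2+* b d)))

  χ₄⋆μ-odd≡0 : ∀ m → ¬ 2 ∣ m → HasPrimeFactor≡1-mod 4 m → χ₄ ⋆μ m ≡ 0ℤ
  χ₄⋆μ-odd≡0 m 2∤m (p , pp , p≡1 , p∣m) = Χ₄.χ⋆μ≡0 m p (∤⇒1≤ 2∤m) pp p∣m (cong χ₄ᵣ p≡1)

  χ₄⋆μ-odd : ∀ m → ¬ 2 ∣ m → ¬ HasPrimeFactor≡1-mod 4 m → χ₄ ⋆μ m ≡ (- 1ℤ) ℤ.^ bigΩ m * + (2 ^ smallω m)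
  χ₄⋆μ-odd m 2∤m no-p≡1 = Χ₄.χ⋆μ≡signed-2^ω m (∤⇒1≤ 2∤m) χ₄q≡-1
    where
    χ₄q≡-1 : ∀ q → Prime q → q ∣ m → χ₄ q ≡ - 1ℤ
    χ₄q≡-1 q pq q∣m with odd-residue-mod-4 q (∤-divisor 2∤m q∣m)
    ... | inj₁ q≡1 = ⊥-elim (no-p≡1 (q , pq , q≡1 , q∣m))
    ... | inj₂ q≡3 = cong χ₄ᵣ q≡3

  χ₄⋆μ-2* : ∀ m → ¬ 2 ∣ m → χ₄ ⋆μ (2 ^ 1 ℕ.* m) ≡ - (χ₄ ⋆μ m)
  χ₄⋆μ-2* m 2∤m = Χ₄.χ⋆μ-p* 2 m refl prime[2] (∤⇒1≤ 2∤m) 2∤m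

  χ₄⋆μ-4∣ : ∀ a m → ¬ 2 ∣ m → 2 ≤ a → χ₄ ⋆μ (2 ^ a ℕ.* m) ≡ 0ℤ
  χ₄⋆μ-4∣ (suc zero)    m 2∤m (s≤s ())
  χ₄⋆μ-4∣ (suc (suc b)) m 2∤m _ = Χ₄.χ⋆μ-p²* 2 b m refl prime[2] (∤⇒1≤ 2∤m) 2∤m

  Jrt-𝕚^k : ∀ {k} → k ≡ 1 ⊎ k ≡ 3 → ∀ n →
            Jrt ℤ[i]Ring 0 (𝕚 ^ᵢ k) n ≡ ⟨ ψ₄ ⋆μ n , χ₄ k * χ₄ ⋆μ n ⟩ᵢ
  Jrt-𝕚^k {k} k≡ n = trans (Jrt-ℤ[i] (𝕚 ^ᵢ k) n) (cong₂ ⟨_,_⟩ᵢ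
    (⋆μ-cong n (λ d _ → cong re (𝕚^k^ k≡ d)))
    (trans (⋆μ-cong n (λ d _ → cong im (𝕚^k^ k≡ d))) (⋆μ-* n (χ₄ k) χ₄)))

  χ₄⋆μ-2^*≡0 : ∀ a m → ¬ 2 ∣ m → χ₄ ⋆μ m ≡ 0ℤ → χ₄ ⋆μ (2 ^ a ℕ.* m) ≡ 0ℤ
  χ₄⋆μ-2^*≡0 zero          m 2∤m χ₄⋆μm≡0 = trans (cong (χ₄ ⋆μ_) (ℕ.*-identityˡ m)) χ₄⋆μm≡0
  χ₄⋆μ-2^*≡0 (suc zero)    m 2∤m χ₄⋆μm≡0 = trans (χ₄⋆μ-2* m 2∤m) (cong -_ χ₄⋆μm≡0)
  χ₄⋆μ-2^*≡0 (suc (suc b)) m 2∤m _       = χ₄⋆μ-4∣ (suc (suc b)) m 2∤m (s≤s (s≤s z≤n))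

  𝕚^k≡ : ∀ {k} → k ≡ 1 ⊎ k ≡ 3 → 𝕚 ^ᵢ k ≡ ⟨ 0ℤ , χ₄ k ⟩ᵢ
  𝕚^k≡ (inj₁ refl) = refl
  𝕚^k≡ (inj₂ refl) = refl

  Jrt-𝕚^k-at-1-2-4 : ∀ {k} → k ≡ 1 ⊎ k ≡ 3 → let ζ = 𝕚 ^ᵢ k in
      Jrt ℤ[i]Ring 0 ζ 1 ≡ ζ
    × Jrt ℤ[i]Ring 0 ζ 2 ≡ intR ℤ[i]Ring (- 1ℤ) -ᵢ ζ
    × Jrt ℤ[i]Ring 0 ζ 4 ≡ intR ℤ[i]Ring (+ 2)
  Jrt-𝕚^k-at-1-2-4 (inj₁ refl) = refl , refl , refl
  Jrt-𝕚^k-at-1-2-4 (inj₂ refl) = refl , refl , refl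

  unit*intR : ∀ s X → ⟨ 0ℤ , s ⟩ᵢ *ᵢ intR ℤ[i]Ring X ≡ ⟨ 0ℤ , s * X ⟩ᵢ
  unit*intR s X rewrite intR-ℤ[i] X = cong₂ ⟨_,_⟩ᵢ
    (solve 2 (λ s x → con 0ℤ :* x :- s :* con 0ℤ := con 0ℤ) refl s X)
    (solve 2 (λ s x → con 0ℤ :* con 0ℤ :+ s :* x := s :* x) refl s X)

  otherwise⇒a≤1×2≤m : ∀ a m → 1 ≤ m → 2 ^ a ℕ.* m ≢ 1 → 2 ^ a ℕ.* m ≢ 2 → 2 ^ a ℕ.* m ≢ 4 →
                   ¬ (3 ≤ a ⊎ (a ≡ 2 × 1 < m)) → (a ≡ 0 ⊎ a ≡ 1) × 2 ≤ m
  otherwise⇒a≤1×2≤m a (suc (suc _)) _ _ _ _ ¬big with a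
  ... | zero                = inj₁ refl , s≤s (s≤s z≤n)
  ... | suc zero            = inj₂ refl , s≤s (s≤s z≤n)
  ... | suc (suc zero)      = ⊥-elim (¬big (inj₂ (refl , s≤s (s≤s z≤n))))
  ... | suc (suc (suc _))   = ⊥-elim (¬big (inj₁ (s≤s (s≤s (s≤s z≤n)))))
  otherwise⇒a≤1×2≤m zero                (suc zero) _ n≢1 _ _ _ = ⊥-elim (n≢1 refl)
  otherwise⇒a≤1×2≤m (suc zero)          (suc zero) _ _ n≢2 _ _ = ⊥-elim (n≢2 refl)
  otherwise⇒a≤1×2≤m (suc (suc zero))    (suc zero) _ _ _ n≢4 _ = ⊥-elim (n≢4 refl)
  otherwise⇒a≤1×2≤m (suc (suc (suc _))) (suc zero) _ _ _ _ ¬big = ⊥-elim (¬big (inj₁ (s≤s (s≤s (s≤s z≤n)))))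

  Jrt-𝕚^k-vanishes : ∀ {k} → k ≡ 1 ⊎ k ≡ 3 → ∀ n → ψ₄ ⋆μ n ≡ 0ℤ → χ₄ ⋆μ n ≡ 0ℤ →
                     Jrt ℤ[i]Ring 0 (𝕚 ^ᵢ k) n ≡ intR ℤ[i]Ring (+ 0)
  Jrt-𝕚^k-vanishes {k} k≡ n ψ₄⋆μn≡0 χ₄⋆μn≡0 = trans (Jrt-𝕚^k k≡ n)
    (cong₂ ⟨_,_⟩ᵢ ψ₄⋆μn≡0 (trans (cong (χ₄ k *_) χ₄⋆μn≡0) (ℤ.*-zeroʳ (χ₄ k))))

  Jrt-𝕚^k-value : ∀ {k} → k ≡ 1 ⊎ k ≡ 3 → ∀ a m → ¬ 2 ∣ m → a ≡ 0 ⊎ a ≡ 1 → 2 ≤ m →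
    ¬ HasPrimeFactor≡1-mod 4 m →
    Jrt ℤ[i]Ring 0 (𝕚 ^ᵢ k) (2 ^ a ℕ.* m)
    ≡ 𝕚 ^ᵢ k *ᵢ intR ℤ[i]Ring ((- 1ℤ) ℤ.^ bigΩ (2 ^ a ℕ.* m) * + (2 ^ smallω m))
  Jrt-𝕚^k-value {k} k≡ a m 2∤m a≤1 2≤m ¬P = begin
    Jrt ℤ[i]Ring 0 (𝕚 ^ᵢ k) (2 ^ a ℕ.* m)
      ≡⟨ Jrt-𝕚^k k≡ (2 ^ a ℕ.* m) ⟩
    ⟨ ψ₄ ⋆μ (2 ^ a ℕ.* m) , χ₄ k * χ₄ ⋆μ (2 ^ a ℕ.* m) ⟩ᵢ
      ≡⟨ cong₂ ⟨_,_⟩ᵢ (ψ₄⋆μ≡0 a m 2∤m (λ _ → 2≤m))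
                     (cong (χ₄ k *_) (Χ₄.χ⋆μ-p^≤1 2 a m _ refl prime[2] (∤⇒1≤ 2∤m) 2∤m a≤1
                                                  (χ₄⋆μ-odd m 2∤m ¬P))) ⟩
    ⟨ 0ℤ , χ₄ k * X ⟩ᵢ
      ≡⟨ sym (trans (cong (_*ᵢ intR ℤ[i]Ring X) (𝕚^k≡ k≡)) (unit*intR (χ₄ k) X)) ⟩
    𝕚 ^ᵢ k *ᵢ intR ℤ[i]Ring X ∎
    where
    open ≡-Reasoning
    X = (- 1ℤ) ℤ.^ bigΩ (2 ^ a ℕ.* m) * + (2 ^ smallω m)

  part-iii : (n a m k : ℕ) → n ≡ 2 ^ a ℕ.* m → m % 2 ≡ 1 → (k ≡ 1 ⊎ k ≡ 3) →
      let ζ = 𝕚 ^ᵢ k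
          v = Jrt ℤ[i]Ring 0 ζ n
      in
      (n ≡ 1 → v ≡ ζ)
    × (n ≡ 2 → v ≡ intR ℤ[i]Ring (- 1ℤ) -ᵢ ζ)
    × (HasPrimeFactor≡1-mod 4 m → v ≡ intR ℤ[i]Ring (+ 0))
    × (n ≡ 4 → v ≡ intR ℤ[i]Ring (+ 2))
    × ((3 ≤ a ⊎ (a ≡ 2 × 1 < m)) → v ≡ intR ℤ[i]Ring (+ 0))
    × (n ≢ 1 → n ≢ 2 → ¬ HasPrimeFactor≡1-mod 4 m → n ≢ 4 → ¬ (3 ≤ a ⊎ (a ≡ 2 × 1 < m)) →
        v ≡ ζ *ᵢ intR ℤ[i]Ring ((- 1ℤ) ℤ.^ bigΩ n * + (2 ^ smallω m)))
  part-iii _ a m k refl m-odd k≡ =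
      (λ e → subst (λ x → v x ≡ ζ) (sym e) (proj₁ (Jrt-𝕚^k-at-1-2-4 k≡)))
    , (λ e → subst (λ x → v x ≡ intR ℤ[i]Ring (- 1ℤ) -ᵢ ζ) (sym e) (proj₁ (proj₂ (Jrt-𝕚^k-at-1-2-4 k≡))))
    , (λ P → Jrt-𝕚^k-vanishes k≡ (2 ^ a ℕ.* m) (ψ₄⋆μ≡0 a m 2∤m (λ _ → has-prime-factor⇒2≤ m 1≤m P))
                                   (χ₄⋆μ-2^*≡0 a m 2∤m (χ₄⋆μ-odd≡0 m 2∤m P)))
    , (λ e → subst (λ x → v x ≡ intR ℤ[i]Ring (+ 2)) (sym e) (proj₂ (proj₂ (Jrt-𝕚^k-at-1-2-4 k≡))))
    , (λ big → Jrt-𝕚^k-vanishes k≡ (2 ^ a ℕ.* m) (ψ₄⋆μ≡0 a m 2∤m (big⇒2≤m big))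
                                                  (χ₄⋆μ-4∣ a m 2∤m (big⇒2≤a big)))
    , λ n≢1 n≢2 ¬P n≢4 ¬big → let (a≤1 , 2≤m) = otherwise⇒a≤1×2≤m a m 1≤m n≢1 n≢2 n≢4 ¬big in
                               Jrt-𝕚^k-value k≡ a m 2∤m a≤1 2≤m ¬P
    where
    ζ = 𝕚 ^ᵢ k
    v = Jrt ℤ[i]Ring 0 ζ
    2∤m = odd⇒2∤ m m-odd
    1≤m = ∤⇒1≤ 2∤m
    big⇒2≤m : 3 ≤ a ⊎ (a ≡ 2 × 1 < m) → a ≡ 1 ⊎ a ≡ 2 → 2 ≤ m
    big⇒2≤m (inj₁ 3≤a)       (inj₁ refl) = ⊥-elim (ℕ.<⇒≱ 3≤a (s≤s z≤n))
    big⇒2≤m (inj₁ 3≤a)       (inj₂ refl) = ⊥-elim (ℕ.<⇒≱ 3≤a (s≤s (s≤s z≤n)))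
    big⇒2≤m (inj₂ (_ , 1<m)) _           = 1<m
    big⇒2≤a : 3 ≤ a ⊎ (a ≡ 2 × 1 < m) → 2 ≤ a
    big⇒2≤a (inj₁ 3≤a)        = ℕ.≤-trans (ℕ.n≤1+n 2) 3≤a
    big⇒2≤a (inj₂ (refl , _)) = ℕ.≤-refl

  -- (iv): ζ = ω, ω²

  module Χ₃ = CompletelyMultiplicative χ₃ χ₃-* refl

  prime[3] : Prime 3
  prime[3] = from-yes (prime? 3)

  reω : ℕ → ℕ → ℤ
  reω k d = re′ ((ω₃ ^ω k) ^ω d)

  Jrt-ω^k : ∀ {k} → k ≡ 1 ⊎ k ≡ 2 → ∀ n →
            Jrt ℤ[ω]Ring 0 (ω₃ ^ω k) n ≡ ⟨ reω k ⋆μ n , χ₃ k * χ₃ ⋆μ n ⟩ω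
  Jrt-ω^k {k} k≡ n = trans (Jrt-ℤ[ω] (ω₃ ^ω k) n)
    (cong (λ x → ⟨ reω k ⋆μ n , x ⟩ω) (trans (⋆μ-cong n (λ d _ → om-ω^k^ k≡ d)) (⋆μ-* n (χ₃ k) χ₃)))

  χ₃⋆μ-coprime≡0 : ∀ m → ¬ 3 ∣ m → HasPrimeFactor≡1-mod 3 m → χ₃ ⋆μ m ≡ 0ℤ
  χ₃⋆μ-coprime≡0 m 3∤m (p , pp , p≡1 , p∣m) = Χ₃.χ⋆μ≡0 m p (∤⇒1≤ 3∤m) pp p∣m (cong χ₃ᵣ p≡1)

  χ₃⋆μ-coprime : ∀ m → ¬ 3 ∣ m → ¬ HasPrimeFactor≡1-mod 3 m → χ₃ ⋆μ m ≡ (- 1ℤ) ℤ.^ bigΩ m * + (2 ^ smallω m)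
  χ₃⋆μ-coprime m 3∤m no-p≡1 = Χ₃.χ⋆μ≡signed-2^ω m (∤⇒1≤ 3∤m) χ₃q≡-1
    where
    χ₃q≡-1 : ∀ q → Prime q → q ∣ m → χ₃ q ≡ - 1ℤ
    χ₃q≡-1 q pq q∣m with residue-mod-3 q (∤-divisor 3∤m q∣m)
    ... | inj₁ q≡1 = ⊥-elim (no-p≡1 (q , pq , q≡1 , q∣m))
    ... | inj₂ q≡2 = cong χ₃ᵣ q≡2

  χ₃⋆μ-3* : ∀ m → ¬ 3 ∣ m → χ₃ ⋆μ (3 ^ 1 ℕ.* m) ≡ - (χ₃ ⋆μ m)
  χ₃⋆μ-3* m 3∤m = Χ₃.χ⋆μ-p* 3 m refl prime[3] (∤⇒1≤ 3∤m) 3∤m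

  χ₃⋆μ-9∣ : ∀ b m → ¬ 3 ∣ m → 2 ≤ b → χ₃ ⋆μ (3 ^ b ℕ.* m) ≡ 0ℤ
  χ₃⋆μ-9∣ (suc zero)    m 3∤m (s≤s ())
  χ₃⋆μ-9∣ (suc (suc b)) m 3∤m _ = Χ₃.χ⋆μ-p²* 3 b m refl prime[3] (∤⇒1≤ 3∤m) 3∤m

  2*reω⋆μ : ∀ {k} → k ≡ 1 ⊎ k ≡ 2 → ∀ m → ¬ 3 ∣ m → 2 ≤ m → + 2 * reω k ⋆μ m ≡ χ₃ k * χ₃ ⋆μ m
  2*reω⋆μ {k} k≡ m 3∤m 2≤m = begin
    + 2 * reω k ⋆μ m                              ≡⟨ sym (⋆μ-* m (+ 2) (reω k)) ⟩
    (λ d → + 2 * reω k d) ⋆μ m                    ≡⟨ ⋆μ-cong m (λ d d∣m → re′-ω^k^-3∤ k≡ d (∤-divisor 3∤m d∣m)) ⟩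
    (λ d → χ₃ k * χ₃ d - 1ℤ) ⋆μ m                 ≡⟨ ⋆μ-- m (λ d → χ₃ k * χ₃ d) (λ _ → 1ℤ) ⟩
    (λ d → χ₃ k * χ₃ d) ⋆μ m - (λ _ → 1ℤ) ⋆μ m    ≡⟨ cong₂ _-_ (⋆μ-* m (χ₃ k) χ₃) (const⋆μ≡0 1ℤ m 2≤m) ⟩
    χ₃ k * χ₃ ⋆μ m - 0ℤ                           ≡⟨ ℤ.+-identityʳ _ ⟩
    χ₃ k * χ₃ ⋆μ m                                ∎
    where open ≡-Reasoning

  reω⋆μ-3* : ∀ {k} → k ≡ 1 ⊎ k ≡ 2 → ∀ m → ¬ 3 ∣ m → 2 ≤ m → reω k ⋆μ (3 ^ 1 ℕ.* m) ≡ - (reω k ⋆μ m)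
  reω⋆μ-3* {k} k≡ m 3∤m 2≤m = begin
    reω k ⋆μ (3 ^ 1 ℕ.* m)                                 ≡⟨ ⋆μ-peel 3 0 m (reω k) prime[3] (∤⇒1≤ 3∤m) 3∤m ⟩
    (λ d → reω k (3 ^ 1 ℕ.* d) - reω k (3 ^ 0 ℕ.* d)) ⋆μ m ≡⟨ ⋆μ-cong m (λ d _ → cong₂ _-_ (re′-ω^k^-3^suc* k≡ 0 d)
                                                                                        (cong (reω k) (ℕ.*-identityˡ d))) ⟩
    (λ d → 1ℤ - reω k d) ⋆μ m                              ≡⟨ ⋆μ-- m (λ _ → 1ℤ) (reω k) ⟩
    (λ _ → 1ℤ) ⋆μ m - reω k ⋆μ m                           ≡⟨ cong (_- reω k ⋆μ m) (const⋆μ≡0 1ℤ m 2≤m) ⟩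
    0ℤ - reω k ⋆μ m                                        ≡⟨ ℤ.+-identityˡ _ ⟩
    - (reω k ⋆μ m)                                         ∎
    where open ≡-Reasoning

  reω⋆μ-9∣ : ∀ {k} → k ≡ 1 ⊎ k ≡ 2 → ∀ b m → ¬ 3 ∣ m → 2 ≤ b → reω k ⋆μ (3 ^ b ℕ.* m) ≡ 0ℤ
  reω⋆μ-9∣ k≡ (suc zero)    m 3∤m (s≤s ())
  reω⋆μ-9∣ {k} k≡ (suc (suc b)) m 3∤m _ = trans (⋆μ-peel 3 (suc b) m (reω k) prime[3] (∤⇒1≤ 3∤m) 3∤m)
    (⋆μ-zero m (λ d _ → cong₂ _-_ (re′-ω^k^-3^suc* k≡ (suc b) d) (re′-ω^k^-3^suc* k≡ b d)))

  χ₃⋆μ-3^*≡0 : ∀ b m → ¬ 3 ∣ m → χ₃ ⋆μ m ≡ 0ℤ → χ₃ ⋆μ (3 ^ b ℕ.* m) ≡ 0ℤ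
  χ₃⋆μ-3^*≡0 zero          m 3∤m χ₃⋆μm≡0 = trans (cong (χ₃ ⋆μ_) (ℕ.*-identityˡ m)) χ₃⋆μm≡0
  χ₃⋆μ-3^*≡0 (suc zero)    m 3∤m χ₃⋆μm≡0 = trans (χ₃⋆μ-3* m 3∤m) (cong -_ χ₃⋆μm≡0)
  χ₃⋆μ-3^*≡0 (suc (suc b)) m 3∤m _       = χ₃⋆μ-9∣ (suc (suc b)) m 3∤m (s≤s (s≤s z≤n))

  reω⋆μ-coprime≡0 : ∀ {k} → k ≡ 1 ⊎ k ≡ 2 → ∀ m → ¬ 3 ∣ m → 2 ≤ m → χ₃ ⋆μ m ≡ 0ℤ → reω k ⋆μ m ≡ 0ℤ
  reω⋆μ-coprime≡0 {k} k≡ m 3∤m 2≤m χ₃⋆μm≡0 = ℤ.*-cancelˡ-≡ (+ 2) (reω k ⋆μ m) 0ℤ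
    (trans (2*reω⋆μ k≡ m 3∤m 2≤m) (trans (cong (χ₃ k *_) χ₃⋆μm≡0) (ℤ.*-zeroʳ (χ₃ k))))

  reω⋆μ-3^*≡0 : ∀ {k} → k ≡ 1 ⊎ k ≡ 2 → ∀ b m → ¬ 3 ∣ m → 2 ≤ m → χ₃ ⋆μ m ≡ 0ℤ → reω k ⋆μ (3 ^ b ℕ.* m) ≡ 0ℤ
  reω⋆μ-3^*≡0 {k} k≡ zero m 3∤m 2≤m χ₃⋆μm≡0 =
    trans (cong (reω k ⋆μ_) (ℕ.*-identityˡ m)) (reω⋆μ-coprime≡0 k≡ m 3∤m 2≤m χ₃⋆μm≡0)
  reω⋆μ-3^*≡0 k≡ (suc zero) m 3∤m 2≤m χ₃⋆μm≡0 =
    trans (reω⋆μ-3* k≡ m 3∤m 2≤m) (cong -_ (reω⋆μ-coprime≡0 k≡ m 3∤m 2≤m χ₃⋆μm≡0))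
  reω⋆μ-3^*≡0 k≡ (suc (suc b)) m 3∤m _ _ = reω⋆μ-9∣ k≡ (suc (suc b)) m 3∤m (s≤s (s≤s z≤n))

  Jrt-ω^k-at-1-3 : ∀ {k} → k ≡ 1 ⊎ k ≡ 2 → let ζ = ω₃ ^ω k in
      Jrt ℤ[ω]Ring 0 ζ 1 ≡ ζ
    × Jrt ℤ[ω]Ring 0 ζ 3 ≡ intR ℤ[ω]Ring (- 1ℤ) *ω ζ +ω intR ℤ[ω]Ring (+ 1)
  Jrt-ω^k-at-1-3 (inj₁ refl) = refl , refl
  Jrt-ω^k-at-1-3 (inj₂ refl) = refl , refl

  ω^k-ω^2k : ∀ {k} → k ≡ 1 ⊎ k ≡ 2 → ω₃ ^ω k -ω ω₃ ^ω (2 ℕ.* k) ≡ ⟨ χ₃ k , + 2 * χ₃ k ⟩ω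
  ω^k-ω^2k (inj₁ refl) = refl
  ω^k-ω^2k (inj₂ refl) = refl

  [s+2sω]*intR : ∀ s X → ⟨ s , + 2 * s ⟩ω *ω intR ℤ[ω]Ring X ≡ ⟨ s * X , + 2 * (s * X) ⟩ω
  [s+2sω]*intR s X rewrite intR-ℤ[ω] X = cong₂ ⟨_,_⟩ω
    (solve 2 (λ s x → s :* x :- con (+ 2) :* s :* con 0ℤ := s :* x) refl s X)
    (solve 2 (λ s x → s :* con 0ℤ :+ con (+ 2) :* s :* x :- con (+ 2) :* s :* con 0ℤ := con (+ 2) :* (s :* x)) refl s X)

  2^smallω : ∀ m → 2 ≤ m → + (2 ^ smallω m) ≡ + 2 * + (2 ^ (smallω m ℕ.∸ 1))
  2^smallω m 2≤m with factor-prime-power m (lpf m) (lpf-prime m 2≤m) (ℕ.≤-trans (s≤s z≤n) 2≤m) (lpf∣ m 2≤m)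
  ... | b , m′ , m≡ , p∤m′ , 1≤m′ =
    subst (λ w → + (2 ^ w) ≡ + 2 * + (2 ^ (w ℕ.∸ 1))) (sym ω≡) (ℤ.pos-* 2 (2 ^ smallω m′))
    where
    ω≡ : smallω m ≡ suc (smallω m′)
    ω≡ = trans (cong smallω m≡) (smallω-prime^* (lpf m) b m′ (lpf-prime m 2≤m) 1≤m′ p∤m′)

  otherwise⇒b≤1×2≤m : ∀ b m → 1 ≤ m → 3 ^ b ℕ.* m ≢ 1 → 3 ^ b ℕ.* m ≢ 3 → ¬ 2 ≤ b → (b ≡ 0 ⊎ b ≡ 1) × 2 ≤ m
  otherwise⇒b≤1×2≤m (suc (suc _)) m _ _ _ b≱2 = ⊥-elim (b≱2 (s≤s (s≤s z≤n)))
  otherwise⇒b≤1×2≤m zero       (suc zero) _ n≢1 _ _ = ⊥-elim (n≢1 refl)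
  otherwise⇒b≤1×2≤m (suc zero) (suc zero) _ _ n≢3 _ = ⊥-elim (n≢3 refl)
  otherwise⇒b≤1×2≤m zero       (suc (suc _)) _ _ _ _ = inj₁ refl , s≤s (s≤s z≤n)
  otherwise⇒b≤1×2≤m (suc zero) (suc (suc _)) _ _ _ _ = inj₂ refl , s≤s (s≤s z≤n)

  coprime-to-3 : ∀ m → gcd m 3 ≡ 1 → ¬ 3 ∣ m
  coprime-to-3 m gcd≡1 3∣m = ℕ.<⇒≢ (s≤s (s≤s z≤n)) (sym (∣1⇒≡1 (subst (3 ∣_) gcd≡1 (gcd-greatest 3∣m ∣-refl))))

  Jrt-ω^k-vanishes : ∀ {k} → k ≡ 1 ⊎ k ≡ 2 → ∀ n → reω k ⋆μ n ≡ 0ℤ → χ₃ ⋆μ n ≡ 0ℤ →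
                     Jrt ℤ[ω]Ring 0 (ω₃ ^ω k) n ≡ intR ℤ[ω]Ring (+ 0)
  Jrt-ω^k-vanishes {k} k≡ n reω⋆μn≡0 χ₃⋆μn≡0 = trans (Jrt-ω^k k≡ n)
    (cong₂ ⟨_,_⟩ω reω⋆μn≡0 (trans (cong (χ₃ k *_) χ₃⋆μn≡0) (ℤ.*-zeroʳ (χ₃ k))))

  2*reω⋆μ-3^≤1 : ∀ {k} → k ≡ 1 ⊎ k ≡ 2 → ∀ b m → ¬ 3 ∣ m → 2 ≤ m → b ≡ 0 ⊎ b ≡ 1 →
                 + 2 * reω k ⋆μ (3 ^ b ℕ.* m) ≡ χ₃ k * χ₃ ⋆μ (3 ^ b ℕ.* m)
  2*reω⋆μ-3^≤1 {k} k≡ b m 3∤m 2≤m (inj₁ refl) =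
    subst (λ x → + 2 * reω k ⋆μ x ≡ χ₃ k * χ₃ ⋆μ x) (sym (ℕ.*-identityˡ m)) (2*reω⋆μ k≡ m 3∤m 2≤m)
  2*reω⋆μ-3^≤1 {k} k≡ b m 3∤m 2≤m (inj₂ refl) = begin
    + 2 * reω k ⋆μ (3 ^ 1 ℕ.* m)    ≡⟨ cong (+ 2 *_) (reω⋆μ-3* k≡ m 3∤m 2≤m) ⟩
    + 2 * - (reω k ⋆μ m)            ≡⟨ sym (ℤ.neg-distribʳ-* (+ 2) (reω k ⋆μ m)) ⟩
    - (+ 2 * reω k ⋆μ m)            ≡⟨ cong -_ (2*reω⋆μ k≡ m 3∤m 2≤m) ⟩
    - (χ₃ k * χ₃ ⋆μ m)              ≡⟨ ℤ.neg-distribʳ-* (χ₃ k) (χ₃ ⋆μ m) ⟩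
    χ₃ k * - (χ₃ ⋆μ m)              ≡⟨ cong (χ₃ k *_) (sym (χ₃⋆μ-3* m 3∤m)) ⟩
    χ₃ k * χ₃ ⋆μ (3 ^ 1 ℕ.* m)      ∎
    where open ≡-Reasoning

  -- Both coordinates carry the factor 2^ω m = 2 · 2^(ω m - 1); the 1-coordinate is half the ω-coordinate.
  Jrt-ω^k-value : ∀ {k} → k ≡ 1 ⊎ k ≡ 2 → ∀ b m → ¬ 3 ∣ m → b ≡ 0 ⊎ b ≡ 1 → 2 ≤ m →
    ¬ HasPrimeFactor≡1-mod 3 m → let N = 3 ^ b ℕ.* m in
    Jrt ℤ[ω]Ring 0 (ω₃ ^ω k) N
    ≡ (ω₃ ^ω k -ω ω₃ ^ω (2 ℕ.* k)) *ω intR ℤ[ω]Ring ((- 1ℤ) ℤ.^ bigΩ N * + (2 ^ (smallω m ℕ.∸ 1)))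
  Jrt-ω^k-value {k} k≡ b m 3∤m b≤1 2≤m ¬P = begin
    Jrt ℤ[ω]Ring 0 (ω₃ ^ω k) N
      ≡⟨ Jrt-ω^k k≡ N ⟩
    ⟨ reω k ⋆μ N , s * χ₃ ⋆μ N ⟩ω
      ≡⟨ cong₂ ⟨_,_⟩ω (ℤ.*-cancelˡ-≡ (+ 2) (reω k ⋆μ N) (s * X) (trans (2*reω⋆μ-3^≤1 k≡ b m 3∤m 2≤m b≤1) s*2X))
                     s*2X ⟩
    ⟨ s * X , + 2 * (s * X) ⟩ω
      ≡⟨ sym (trans (cong (_*ω intR ℤ[ω]Ring X) (ω^k-ω^2k k≡)) ([s+2sω]*intR s X)) ⟩
    (ω₃ ^ω k -ω ω₃ ^ω (2 ℕ.* k)) *ω intR ℤ[ω]Ring X ∎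
    where
    open ≡-Reasoning
    N = 3 ^ b ℕ.* m
    s = χ₃ k
    X = (- 1ℤ) ℤ.^ bigΩ N * + (2 ^ (smallω m ℕ.∸ 1))
    χ₃⋆μN≡2X : χ₃ ⋆μ N ≡ + 2 * X
    χ₃⋆μN≡2X = trans (Χ₃.χ⋆μ-p^≤1 3 b m _ refl prime[3] (∤⇒1≤ 3∤m) 3∤m b≤1 (χ₃⋆μ-coprime m 3∤m ¬P))
      (trans (cong ((- 1ℤ) ℤ.^ bigΩ N *_) (2^smallω m 2≤m))
             (solve 2 (λ a t → a :* (con (+ 2) :* t) := con (+ 2) :* (a :* t))
                      refl ((- 1ℤ) ℤ.^ bigΩ N) (+ (2 ^ (smallω m ℕ.∸ 1)))))
    s*2X : s * χ₃ ⋆μ N ≡ + 2 * (s * X)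
    s*2X = trans (cong (s *_) χ₃⋆μN≡2X) (solve 2 (λ s x → s :* (con (+ 2) :* x) := con (+ 2) :* (s :* x)) refl s X)

  part-iv : (n b m₁ k : ℕ) → n ≡ 3 ^ b ℕ.* m₁ → gcd m₁ 3 ≡ 1 → (k ≡ 1 ⊎ k ≡ 2) →
      let ζ = ω₃ ^ω k
          v = Jrt ℤ[ω]Ring 0 ζ n
      in
      (n ≡ 1 → v ≡ ζ)
    × (n ≡ 3 → v ≡ intR ℤ[ω]Ring (- 1ℤ) *ω ζ +ω intR ℤ[ω]Ring (+ 1))
    × (HasPrimeFactor≡1-mod 3 m₁ → v ≡ intR ℤ[ω]Ring (+ 0))
    × (2 ≤ b → v ≡ intR ℤ[ω]Ring (+ 0))
    × (n ≢ 1 → n ≢ 3 → ¬ HasPrimeFactor≡1-mod 3 m₁ → ¬ (2 ≤ b) →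
        v ≡ (ζ -ω ω₃ ^ω (2 ℕ.* k)) *ω intR ℤ[ω]Ring ((- 1ℤ) ℤ.^ bigΩ n * + (2 ^ (smallω m₁ ℕ.∸ 1))))
  part-iv _ b m k refl gcd≡1 k≡ =
      (λ e → subst (λ x → v x ≡ ζ) (sym e) (proj₁ (Jrt-ω^k-at-1-3 k≡)))
    , (λ e → subst (λ x → v x ≡ intR ℤ[ω]Ring (- 1ℤ) *ω ζ +ω intR ℤ[ω]Ring (+ 1)) (sym e)
                   (proj₂ (Jrt-ω^k-at-1-3 k≡)))
    , (λ P → let χ₃⋆μm≡0 = χ₃⋆μ-coprime≡0 m 3∤m P in
             Jrt-ω^k-vanishes k≡ (3 ^ b ℕ.* m) (reω⋆μ-3^*≡0 k≡ b m 3∤m (has-prime-factor⇒2≤ m 1≤m P) χ₃⋆μm≡0)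
                                                (χ₃⋆μ-3^*≡0 b m 3∤m χ₃⋆μm≡0))
    , (λ 2≤b → Jrt-ω^k-vanishes k≡ (3 ^ b ℕ.* m) (reω⋆μ-9∣ k≡ b m 3∤m 2≤b) (χ₃⋆μ-9∣ b m 3∤m 2≤b))
    , λ n≢1 n≢3 ¬P b≱2 → let (b≤1 , 2≤m) = otherwise⇒b≤1×2≤m b m 1≤m n≢1 n≢3 b≱2 in
                         Jrt-ω^k-value k≡ b m 3∤m b≤1 2≤m ¬P
    where
    ζ = ω₃ ^ω k
    v = Jrt ℤ[ω]Ring 0 ζ
    3∤m = coprime-to-3 m gcd≡1
    1≤m = ∤⇒1≤ 3∤m

open import Defs
open import Data.Nat using (ℕ; _*_; _^_; _∸_; _≤_; _<_; _%_)
open import Data.Nat.Divisibility using (_∣_)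
open import Data.Nat.Primality using (Prime)
open import Data.Nat.GCD using (gcd)
open import Data.Integer as ℤ using (ℤ; +_; -[1+_])
open import Data.Product using (_×_; ∃; _,_)
open import Data.Sum using (_⊎_)
open import Relation.Nullary using (¬_)
open import Relation.Binary.PropositionalEquality using (_≡_; _≢_)

open JordanRootTotient using (part-i; part-ii; part-iii; part-iv)

lemma6p2 :
  -- (i)
  ((n : ℕ) → 1 ≤ n →
      (n ≡ 1 → Jrt ℤRing 0 (ℤ.- ℤ.1ℤ) n ≡ -[1+ 0 ])
    × (n ≡ 2 → Jrt ℤRing 0 (ℤ.- ℤ.1ℤ) n ≡ + 2)
    × (2 < n → Jrt ℤRing 0 (ℤ.- ℤ.1ℤ) n ≡ + 0))
  -- (ii)
  × ((n a m : ℕ) → n ≡ 2 ^ a * m → m % 2 ≡ 1 →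
      (a ≡ 0 → Jrt ℤRing 1 (ℤ.- ℤ.1ℤ) n ≡ ℤ.- (+ φ n))
    × (a ≡ 1 → Jrt ℤRing 1 (ℤ.- ℤ.1ℤ) n ≡ + (3 * φ n))
    × (2 ≤ a → Jrt ℤRing 1 (ℤ.- ℤ.1ℤ) n ≡ + φ n))
  -- (iii)
  × ((n a m k : ℕ) → n ≡ 2 ^ a * m → m % 2 ≡ 1 → (k ≡ 1 ⊎ k ≡ 3) →
      let ζ = powR ℤ[i]Ring 𝕚 k
          v = Jrt ℤ[i]Ring 0 ζ n
      in
      (n ≡ 1 → v ≡ ζ)
    × (n ≡ 2 → v ≡ intR ℤ[i]Ring (ℤ.- ℤ.1ℤ) -ᵢ ζ)
    × ((∃ λ p → Prime p × p % 4 ≡ 1 × p ∣ m) → v ≡ intR ℤ[i]Ring (+ 0))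
    × (n ≡ 4 → v ≡ intR ℤ[i]Ring (+ 2))
    × ((3 ≤ a ⊎ (a ≡ 2 × 1 < m)) → v ≡ intR ℤ[i]Ring (+ 0))
    × (n ≢ 1 → n ≢ 2 → ¬ (∃ λ p → Prime p × p % 4 ≡ 1 × p ∣ m) → n ≢ 4 →
        ¬ (3 ≤ a ⊎ (a ≡ 2 × 1 < m)) →
        v ≡ ζ *ᵢ intR ℤ[i]Ring ((ℤ.- ℤ.1ℤ) ℤ.^ bigΩ n ℤ.* + (2 ^ smallω m))))
  -- (iv)
  × ((n b m₁ k : ℕ) → n ≡ 3 ^ b * m₁ → gcd m₁ 3 ≡ 1 → (k ≡ 1 ⊎ k ≡ 2) →
      let ζ = powR ℤ[ω]Ring ω₃ k
          v = Jrt ℤ[ω]Ring 0 ζ n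
      in
      (n ≡ 1 → v ≡ ζ)
    × (n ≡ 3 → v ≡ intR ℤ[ω]Ring (ℤ.- ℤ.1ℤ) *ω ζ +ω intR ℤ[ω]Ring (+ 1))
    × ((∃ λ p → Prime p × p % 3 ≡ 1 × p ∣ m₁) → v ≡ intR ℤ[ω]Ring (+ 0))
    × (2 ≤ b → v ≡ intR ℤ[ω]Ring (+ 0))
    × (n ≢ 1 → n ≢ 3 → ¬ (∃ λ p → Prime p × p % 3 ≡ 1 × p ∣ m₁) → ¬ (2 ≤ b) →
        v ≡ (ζ -ω powR ℤ[ω]Ring ω₃ (2 * k))
              *ω intR ℤ[ω]Ring ((ℤ.- ℤ.1ℤ) ℤ.^ bigΩ n ℤ.* + (2 ^ (smallω m₁ ∸ 1)))))
lemma6p2 = part-i , part-ii , part-iii , part-iv
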